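{- Let $D \neq 1$ be a square-free integer, let $p$ be an odd prime, let $k,\ell$ be positive integers, and let $c_D$ be a positive integer with $\gcd(c_D k, p) = 1$. Let $N = c_D k p^\ell - 1$, and assume $N$ is odd, that the Jacobi symbol satisfies $\left(\frac{D}{N}\right) = -1$, and that $c_D k < p^\ell$. Suppose there exists $w \in \mathcal{G}_N(D)$ such that $w^{\frac{N+1}{p}} \not\equiv 1 \pmod N$. Then $N$ is prime if and only if $$\Phi_p\left(w^{\frac{N+1}{p}}\right) \equiv 0 \pmod N,$$ where $\Phi_p(x) = x^{p-1} + \dots + x + 1$ is the $p$-th cyclotomic polynomial.
   Context: For an integer $n \ge 2$ and square-free $D \neq 1$: if $D \equiv 2,3 \pmod 4$, let $\mathcal{I}_n(D) = \{a + b\sqrt{D} : a,b \in \mathbb{Z}/n\mathbb{Z}\}$ (the ring $\mathbb{Z}[\sqrt D]/n\mathbb{Z}[\sqrt D]$) and $\mathcal{G}_n(D) = \{a + b\sqrt{D} \in \mathcal{I}_n(D) : a^2 - Db^2 \equiv 1 \pmod n\}$. If $D \equiv 1 \pmod 4$, let $\omega = \frac{1+\sqrt D}{2}$, $\mathcal{I}_n(D) = \{a + b\omega : a,b \in \mathbb{Z}/n\mathbb{Z}\}$ (the ring $\mathbb{Z}[\omega]/n\mathbb{Z}[\omega]$) and $\mathcal{G}_n(D) = \{a + b\omega \in \mathcal{I}_n(D) : a^2 + ab + \frac{1-D}{4} b^2 \equiv 1 \pmod n\}$. $\mathcal{G}_n(D)$ is a group under the multiplication of $\mathcal{I}_n(D)$.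 A congruence $x \equiv y \pmod n$ between elements of $\mathcal{I}_n(D)$ means $x = y$ in $\mathcal{I}_n(D)$. -}

module Defs where

open import Data.Nat as ℕ using (ℕ; zero; suc)
open import Data.Nat.Primality using (Prime)
import Data.Nat.Divisibility as ℕD
open import Data.Integer as ℤ using (ℤ; +_; -_; _-_; _+_; _*_; ∣_∣; 1ℤ; 0ℤ)
open import Data.Integer.Divisibility as ℤD using ()
open import Data.Integer.DivMod as ℤDM using ()
open import Data.Bool using (Bool; true; false; if_then_else_)
open import Data.Product using (_×_; _,_; ∃-syntax)
open import Relation.Nullary using (¬_)
open import Relation.Binary.PropositionalEquality using (_≡_; _≢_)

-- Square-free integer: no square of a prime divides D (this excludes D = 0).
SquareFree : ℤ → Set
SquareFree D = ∀ q → Prime q → ¬ ((q ℕ.* q) ℕD.∣ ∣ D ∣)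

infix 4 _≡ᵢ_[mod_] _≡I_[mod_]

_≡ᵢ_[mod_] : ℤ → ℤ → ℕ → Set
x ≡ᵢ y [mod n ] = (+ n) ℤD.∣ (x - y)

data LegendreIs (a : ℤ) (q : ℕ) : ℤ → Set where
  leg-zero : (+ q) ℤD.∣ a → LegendreIs a q 0ℤ
  leg-res  : ¬ ((+ q) ℤD.∣ a) → (∃[ x ] (x * x ≡ᵢ a [mod q ])) → LegendreIs a q 1ℤ
  leg-non  : ¬ ((+ q) ℤD.∣ a) → (∀ x → ¬ (x * x ≡ᵢ a [mod q ])) → LegendreIs a q (- 1ℤ)

data JacobiIs (a : ℤ) : ℕ → ℤ → Set where
  jac-one : JacobiIs a 1 1ℤ
  jac-mul : ∀ {q m s t} → Prime q → q ≢ 2 → LegendreIs a q s → JacobiIs a m t →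
            JacobiIs a (q ℕ.* m) (s * t)

-- The ring I_n(D): elements a + bθ represented by pairs (a , b) of integers,
-- where θ = √D if D ≡ 2,3 (mod 4) and θ = ω = (1+√D)/2 if D ≡ 1 (mod 4).

oneMod4 : ℤ → Bool
oneMod4 D with D ℤDM.% (+ 4)
... | 1 = true
... | _ = false

Elt : Set
Elt = ℤ × ℤ

-- multiplication in Z[√D] resp. Z[ω]  (ω² = ω + (D-1)/4)
mulI : ℤ → Elt → Elt → Elt
mulI D (a , b) (c , d) with oneMod4 D
... | false = (a * c + D * b * d , a * d + b * c)
... | true  = (a * c + ((D - 1ℤ) ℤDM./ (+ 4)) * b * d , a * d + b * c + b * d)

normI : ℤ → Elt → ℤ
normI D (a , b) with oneMod4 D
... | false = a * a - D * b * b
... | true  = a * a + a * b + ((1ℤ - D) ℤDM./ (+ 4)) * b * b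

oneI : Elt
oneI = (1ℤ , 0ℤ)

zeroI : Elt
zeroI = (0ℤ , 0ℤ)

addI : Elt → Elt → Elt
addI (a , b) (c , d) = (a + c , b + d)

powI : ℤ → Elt → ℕ → Elt
powI D w zero    = oneI
powI D w (suc e) = mulI D (powI D w e) w

_≡I_[mod_] : Elt → Elt → ℕ → Set
(a , b) ≡I (c , d) [mod n ] = (a ≡ᵢ c [mod n ]) × (b ≡ᵢ d [mod n ])

InG : ℕ → ℤ → Elt → Set
InG n D w = normI D w ≡ᵢ 1ℤ [mod n ]

geomSum : ℤ → Elt → ℕ → Elt
geomSum D x zero    = zeroI
geomSum D x (suc m) = addI (geomSum D x m) (powI D x m)

cyclotomicI : ℤ → ℕ → Elt → Elt
cyclotomicI D p x = geomSum D x p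

module Submission where

-- Write N + 1 = u·P with P = p^ℓ, put E = (N + 1)/p and X = w^E, and compute in
-- ℤ[θ]/r for the primes r ∣ N, where θ² = sθ + t has discriminant Δ ∈ {D, 4D}.
--
-- If N is prime, (D/N) = -1 makes Δ a non-residue, so by Euler's criterion the
-- Frobenius u ↦ u^N is conjugation and w^(N+1) = norm w = 1.  Then X^p = 1, and as
-- ℤ[θ]/N is a field and X ≠ 1, Φ_p(X) = (X^p - 1)/(X - 1) vanishes.
--
-- Conversely, if Φ_p(X) ≡ 0 (mod N) then for each prime r ∣ N we get X^p ≡ 1 and
-- X ≢ 1 (mod r) (else r ∣ Φ_p(1) = p), so P divides every M with w^M ≡ 1 (mod r).
-- By the same Frobenius computation one of r + 1, r - 1, 2r is such an M; as P is
-- odd and prime to r, P ≤ r.  Since N < u·P < P², N is prime.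

open import Algebra.Bundles using (CommutativeRing; CommutativeSemiring)
open import Algebra.Core using (Op₁; Op₂)
open import Algebra.Definitions using (Congruent₁; Congruent₂)
open import Algebra.Structures using (IsCommutativeRing)
open import Data.Bool using (true; false; if_then_else_)
open import Data.Empty using (⊥)
open import Data.Fin using (Fin; zero; suc; toℕ; inject₁; fromℕ)
import Data.Fin.Properties as Fin
open import Data.Integer as ℤ using (ℤ; +_; -_; 0ℤ; 1ℤ; ∣_∣)
import Data.Integer.DivMod as ℤ
open import Data.Integer.Divisibility.Signed as ℤˢ using (divides; ∣ᵤ⇒∣; ∣⇒∣ᵤ)
import Data.Integer.Properties as ℤ
open import Data.Integer.Tactic.RingSolver using (solve-∀; solve)
open import Data.List using (List; []; _∷_; _++_; [_]; _∷ʳ_; length; applyUpTo)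
open import Data.List.Membership.Propositional using (_∈_; _∉_)
open import Data.List.Membership.Propositional.Properties using (∈-∃++; ∈-applyUpTo⁺; ∈-applyUpTo⁻)
open import Data.List.Properties using (length-applyUpTo; applyUpTo-∷ʳ)
open import Data.List.Relation.Binary.Permutation.Propositional using (_↭_; ↭-prep; ↭-sym; ↭⇒↭ₛ)
open import Data.List.Relation.Binary.Permutation.Propositional.Properties using (shift; ∈-resp-↭; ↭-length)
import Data.List.Relation.Binary.Permutation.Setoid.Properties as ↭ₛ
import Data.List.Relation.Unary.All as All
import Data.List.Relation.Unary.AllPairs as AllPairs
open import Data.List.Relation.Unary.Any using (here; there)
open import Data.List.Relation.Unary.Unique.Propositional using (Unique)
open import Data.List.Relation.Unary.Unique.Propositional.Properties using (applyUpTo⁺₁)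
open import Data.Nat as ℕ using (ℕ; zero; suc; _!)
open import Data.Nat.Combinatorics using (_C_; nCk≡n!/k![n-k]!; k![n∸k]!∣n!; nCn≡1)
open import Data.Nat.Coprimality using (Coprime; coprime-divisor)
open import Data.Nat.Divisibility using (hasNonTrivialDivisor)
import Data.Nat.Divisibility as ℕ
import Data.Nat.DivMod as ℕ
open import Data.Nat.GCD using (gcd; gcd-GCD; gcd[m,n]∣m; gcd[m,n]∣n; module Bézout)
open import Data.Nat.ListAction using (product)
open import Data.Nat.ListAction.Properties using (product-↭; product-++)
open import Data.Nat.Primality
  using (Prime; _Rough_; euclidsLemma; prime⇒nonTrivial; prime⇒nonZero; prime⇒irreducible; prime[2]; rough∧square>⇒prime)
open import Data.Nat.Primality.Factorisation using (factorise)
import Data.Nat.Properties as ℕ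
import Data.Nat.Tactic.RingSolver as ℕ
open import Data.Product using (_,_; _×_; ∃; proj₁; proj₂)
open import Data.Sum using (_⊎_; inj₁; inj₂; [_,_]′)
import Data.Sum
open import Data.Vec.Functional using (head; init; last; tail)
open import Function using (_∘_; flip; id)
open import Level using (0ℓ)
open import Relation.Binary using (Rel; IsEquivalence)
open import Relation.Binary.PropositionalEquality as ≡ using (_≡_; _≢_; refl; cong; subst)
open import Relation.Nullary using (Dec; yes; no; ¬_; contradiction)
open import Relation.Nullary.Decidable using (map′)

open import Defs

open ↭ₛ (≡.setoid ℕ) using (Unique-resp-↭)

-- Congruences of integers

infix 4 _≈_[mod_]

record _≈_[mod_] (x y : ℤ) (n : ℕ) : Set where
  constructor mk≈
  field n∣x-y : + n ℤˢ.∣ x ℤ.- y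
open _≈_[mod_]

module _ {n : ℕ} where

  private
    by : ∀ {x y e} → + n ℤˢ.∣ e → e ≡ x ℤ.- y → x ≈ y [mod n ]
    by n∣e refl = mk≈ n∣e

  ≈-refl : ∀ {x} → x ≈ x [mod n ]
  ≈-refl {x} = by (divides 0ℤ refl) (≡.sym (ℤ.+-inverseʳ x))

  ≈-reflexive : ∀ {x y} → x ≡ y → x ≈ y [mod n ]
  ≈-reflexive refl = ≈-refl

  ≈-sym : ∀ {x y} → x ≈ y [mod n ] → y ≈ x [mod n ]
  ≈-sym {x} {y} x≈y = by (ℤˢ.∣m⇒∣-m (n∣x-y x≈y)) (solve (x ∷ y ∷ []))

  ≈-trans : ∀ {x y z} → x ≈ y [mod n ] → y ≈ z [mod n ] → x ≈ z [mod n ]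
  ≈-trans {x} {y} {z} x≈y y≈z = by (ℤˢ.∣m∣n⇒∣m+n (n∣x-y x≈y) (n∣x-y y≈z)) (solve (x ∷ y ∷ z ∷ []))

  ≈-+-cong : ∀ {x y u v} → x ≈ y [mod n ] → u ≈ v [mod n ] → x ℤ.+ u ≈ y ℤ.+ v [mod n ]
  ≈-+-cong {x} {y} {u} {v} x≈y u≈v =
    by (ℤˢ.∣m∣n⇒∣m+n (n∣x-y x≈y) (n∣x-y u≈v)) (solve (x ∷ y ∷ u ∷ v ∷ []))

  ≈-*-cong : ∀ {x y u v} → x ≈ y [mod n ] → u ≈ v [mod n ] → x ℤ.* u ≈ y ℤ.* v [mod n ]
  ≈-*-cong {x} {y} {u} {v} x≈y u≈v =
    by (ℤˢ.∣m∣n⇒∣m+n (ℤˢ.∣m⇒∣m*n u (n∣x-y x≈y)) (ℤˢ.∣n⇒∣m*n y (n∣x-y u≈v)))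
       (solve (x ∷ y ∷ u ∷ v ∷ []))

  ≈-neg-cong : ∀ {x y} → x ≈ y [mod n ] → - x ≈ - y [mod n ] 
  ≈-neg-cong {x} {y} x≈y = by (ℤˢ.∣m⇒∣-m (n∣x-y x≈y)) (solve (x ∷ y ∷ []))

  ≈-isEquivalence : IsEquivalence (λ x y → x ≈ y [mod n ])
  ≈-isEquivalence = record { refl = ≈-refl ; sym = ≈-sym ; trans = ≈-trans }

  ≈-^-cong : ∀ {x y} k → x ≈ y [mod n ] → x ℤ.^ k ≈ y ℤ.^ k [mod n ]
  ≈-^-cong zero x≈y = ≈-refl
  ≈-^-cong (suc k) x≈y = ≈-*-cong x≈y (≈-^-cong k x≈y)

  x-y≈0⇒x≈y : ∀ {x y} → x ℤ.- y ≈ 0ℤ [mod n ] → x ≈ y [mod n ]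
  x-y≈0⇒x≈y {x} {y} (mk≈ n∣x-y-0) = mk≈ (subst (+ n ℤˢ.∣_) (ℤ.+-identityʳ (x ℤ.- y)) n∣x-y-0)

  x≈y⇒x-y≈0 : ∀ {x y} → x ≈ y [mod n ] → x ℤ.- y ≈ 0ℤ [mod n ]
  x≈y⇒x-y≈0 {x} {y} (mk≈ n∣x-y) = mk≈ (subst (+ n ℤˢ.∣_) (≡.sym (ℤ.+-identityʳ (x ℤ.- y))) n∣x-y)

  ≈-weaken : ∀ {m x y} → m ℕ.∣ n → x ≈ y [mod n ] → x ≈ y [mod m ]
  ≈-weaken m∣n (mk≈ n∣x-y) = mk≈ (ℤˢ.∣-trans (∣ᵤ⇒∣ m∣n) n∣x-y)

  ≈⇒≡ᵢ : ∀ {x y} → x ≈ y [mod n ] → x ≡ᵢ y [mod n ]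
  ≈⇒≡ᵢ (mk≈ n∣x-y) = ∣⇒∣ᵤ n∣x-y

  ≡ᵢ⇒≈ : ∀ {x y} → x ≡ᵢ y [mod n ] → x ≈ y [mod n ]
  ≡ᵢ⇒≈ n∣x-y = mk≈ (∣ᵤ⇒∣ n∣x-y)

  ≈0⇒∣ : ∀ {x} → x ≈ 0ℤ [mod n ] → n ℕ.∣ ∣ x ∣
  ≈0⇒∣ {x} x≈0 = subst (λ z → n ℕ.∣ ∣ z ∣) (ℤ.+-identityʳ x) (≈⇒≡ᵢ x≈0)

  ∣⇒≈0 : ∀ {x} → n ℕ.∣ ∣ x ∣ → x ≈ 0ℤ [mod n ]
  ∣⇒≈0 {x} n∣x = ≡ᵢ⇒≈ (subst (λ z → n ℕ.∣ ∣ z ∣) (≡.sym (ℤ.+-identityʳ x)) n∣x)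

  ≈0? : ∀ x → Dec (x ≈ 0ℤ [mod n ])
  ≈0? x = map′ ∣⇒≈0 ≈0⇒∣ (n ℕ.∣? ∣ x ∣)

  n≈0 : + n ≈ 0ℤ [mod n ]
  n≈0 = ∣⇒≈0 ℕ.∣-refl

  ≈-%ℕ : ∀ a .{{_ : ℕ.NonZero n}} → a ≈ + (a ℤ.%ℕ n) [mod n ]
  ≈-%ℕ a = mk≈ (divides (a ℤ./ℕ n) (≡.trans (cong (ℤ._- r) (ℤ.a≡a%ℕn+[a/ℕn]*n a n)) (cancel r _)))
    where
    r : ℤ
    r = + (a ℤ.%ℕ n)
    cancel : ∀ r k → r ℤ.+ k ℤ.- r ≡ k
    cancel = solve-∀

  private
    ≈-≤-< : ∀ {a b} → b ℕ.≤ a → a ℕ.< n → + a ≈ + b [mod n ] → a ≡ b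
    ≈-≤-< {a} {b} b≤a a<n a≈b =
      ℕ.≤-antisym (ℕ.m∸n≡0⇒m≤n (small (ℕ.≤-<-trans (ℕ.m∸n≤m a b) a<n) n∣a∸b)) b≤a
      where
      n∣a∸b : n ℕ.∣ a ℕ.∸ b
      n∣a∸b = subst (λ z → n ℕ.∣ ∣ z ∣) (≡.trans (ℤ.m-n≡m⊖n a b) (ℤ.⊖-≥ b≤a)) (≈⇒≡ᵢ a≈b)
      small : ∀ {d} → d ℕ.< n → n ℕ.∣ d → d ≡ 0
      small {zero} _ _ = refl
      small {suc d} d<n n∣d = contradiction (ℕ.∣⇒≤ n∣d) (ℕ.<⇒≱ d<n)

  ≈-< : ∀ {a b} → a ℕ.< n → b ℕ.< n → + a ≈ + b [mod n ] → a ≡ b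
  ≈-< {a} {b} a<n b<n a≈b with ℕ.≤-total a b
  ... | inj₁ a≤b = ≡.sym (≈-≤-< a≤b b<n (≈-sym a≈b))
  ... | inj₂ b≤a = ≈-≤-< b≤a a<n a≈b

prime-≈0-* : ∀ {q a b} → Prime q → a ℤ.* b ≈ 0ℤ [mod q ] → a ≈ 0ℤ [mod q ] ⊎ b ≈ 0ℤ [mod q ]
prime-≈0-* {q} {a} {b} q-prime ab≈0 =
  Data.Sum.map ∣⇒≈0 ∣⇒≈0 (euclidsLemma ∣ a ∣ ∣ b ∣ q-prime (subst (q ℕ.∣_) (ℤ.abs-* a b) (≈0⇒∣ ab≈0)))

-- Residue rings

module _ {A : Set} {_+_ _*_ : Op₂ A} { -_ : Op₁ A} {0# 1# : A}
         (exact : IsCommutativeRing _≡_ _+_ _*_ -_ 0# 1#)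
         {_∼_ : Rel A 0ℓ} (∼-equiv : IsEquivalence _∼_)
         (+-cong : Congruent₂ _∼_ _+_) (*-cong : Congruent₂ _∼_ _*_) (neg-cong : Congruent₁ _∼_ -_)
  where

  private
    module R = IsCommutativeRing exact
    lift : ∀ {x y} → x ≡ y → x ∼ y
    lift refl = IsEquivalence.refl ∼-equiv

  congruence⇒isCommutativeRing : IsCommutativeRing _∼_ _+_ _*_ -_ 0# 1#
  congruence⇒isCommutativeRing = record
    { isRing = record
      { +-isAbelianGroup = record
        { isGroup = record
          { isMonoid = record
            { isSemigroup = record
              { isMagma = record { isEquivalence = ∼-equiv ; ∙-cong = +-cong }
              ; assoc = λ x y z → lift (R.+-assoc x y z) }
            ; identity = (λ x → lift (R.+-identityˡ x)) , (λ x → lift (R.+-identityʳ x)) }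
          ; inverse = (λ x → lift (R.-‿inverseˡ x)) , (λ x → lift (R.-‿inverseʳ x))
          ; ⁻¹-cong = neg-cong }
        ; comm = λ x y → lift (R.+-comm x y) }
      ; *-cong = *-cong
      ; *-assoc = λ x y z → lift (R.*-assoc x y z)
      ; *-identity = (λ x → lift (R.*-identityˡ x)) , (λ x → lift (R.*-identityʳ x))
      ; distrib = (λ x y z → lift (R.distribˡ x y z)) , (λ x y z → lift (R.distribʳ x y z)) }
    ; *-comm = λ x y → lift (R.*-comm x y) }

ℤ/_ : ℕ → CommutativeRing 0ℓ 0ℓ
ℤ/ n = record
  { isCommutativeRing =
      congruence⇒isCommutativeRing ℤ.+-*-isCommutativeRing (≈-isEquivalence {n}) ≈-+-cong ≈-*-cong ≈-neg-cong }

-- Divisibility and primality in ℕ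

prime>1 : ∀ {q} → Prime q → 1 ℕ.< q
prime>1 {q} q-prime = ℕ.nonTrivial⇒n>1 q {{prime⇒nonTrivial q-prime}}

prime∤! : ∀ {q j} → Prime q → j ℕ.< q → ¬ q ℕ.∣ j !
prime∤! {j = zero} q-prime _ q∣1 = ℕ.<⇒≢ (prime>1 q-prime) (≡.sym (ℕ.∣1⇒≡1 q∣1))
prime∤! {j = suc j} q-prime j<q q∣j! with euclidsLemma (suc j) (j !) q-prime q∣j!
... | inj₁ q∣1+j = ℕ.<⇒≱ j<q (ℕ.∣⇒≤ q∣1+j)
... | inj₂ q∣j! = prime∤! q-prime (ℕ.<-trans (ℕ.n<1+n j) j<q) q∣j!

prime∣C : ∀ {q k} → Prime q → 0 ℕ.< k → k ℕ.< q → q ℕ.∣ q C k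
prime∣C {q@(suc q-1)} {k} q-prime 0<k k<q
  with euclidsLemma (q C k) (k ! ℕ.* (q ℕ.∸ k) !) q-prime q∣C*k!*[q-k]!
  where
  instance _ = ℕ._!*_!≢0 k (q ℕ.∸ k)
  q∣C*k!*[q-k]! : q ℕ.∣ (q C k) ℕ.* (k ! ℕ.* (q ℕ.∸ k) !)
  q∣C*k!*[q-k]! = subst (q ℕ.∣_)
    (≡.sym (≡.trans (cong (ℕ._* (k ! ℕ.* (q ℕ.∸ k) !)) (nCk≡n!/k![n-k]! (ℕ.<⇒≤ k<q)))
                    (ℕ.m/n*n≡m (k![n∸k]!∣n! (ℕ.<⇒≤ k<q)))))
    (ℕ.m∣m*n (q-1 !))
... | inj₁ q∣C = q∣C
... | inj₂ q∣k!*[q-k]! with euclidsLemma (k !) ((q ℕ.∸ k) !) q-prime q∣k!*[q-k]!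
...   | inj₁ q∣k! = contradiction q∣k! (prime∤! q-prime k<q)
...   | inj₂ q∣[q-k]! = contradiction q∣[q-k]! (prime∤! q-prime (ℕ.∸-monoʳ-< 0<k (ℕ.<⇒≤ k<q)))

prime-power-∣-* : ∀ {p} → Prime p → ∀ ℓ {x c} → ¬ p ℕ.∣ c → p ℕ.^ ℓ ℕ.∣ x ℕ.* c → p ℕ.^ ℓ ℕ.∣ x
prime-power-∣-* p-prime zero _ _ = ℕ.1∣ _
prime-power-∣-* {p} p-prime (suc ℓ) {x} {c} p∤c pᶫ⁺¹∣xc
  with euclidsLemma x c p-prime (ℕ.∣-trans (ℕ.m∣m*n (p ℕ.^ ℓ)) pᶫ⁺¹∣xc)
... | inj₂ p∣c = contradiction p∣c p∤c
... | inj₁ (ℕ.divides x′ refl) =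
  subst (p ℕ.^ suc ℓ ℕ.∣_) (ℕ.*-comm p x′) (ℕ.*-monoʳ-∣ p (prime-power-∣-* p-prime ℓ p∤c pᶫ∣x′c))
  where
  instance _ = prime⇒nonZero p-prime
  pᶫ∣x′c : p ℕ.^ ℓ ℕ.∣ x′ ℕ.* c
  pᶫ∣x′c = ℕ.*-cancelˡ-∣ p (subst (p ℕ.^ suc ℓ ℕ.∣_) (regroup x′ p c) pᶫ⁺¹∣xc)
    where
    regroup : ∀ x p c → x ℕ.* p ℕ.* c ≡ p ℕ.* (x ℕ.* c)
    regroup = ℕ.solve-∀

∃-prime-factor : ∀ {d} → 1 ℕ.< d → ∃ λ r → Prime r × r ℕ.∣ d
∃-prime-factor {d} 1<d with factorise d {{ℕ.>-nonZero (ℕ.<-trans (ℕ.s≤s ℕ.z≤n) 1<d)}}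
... | record { factors = [] ; isFactorisation = d≡1 } = contradiction d≡1 (ℕ.>⇒≢ 1<d)
... | record { factors = r ∷ rs ; isFactorisation = d≡r·∏rs ; factorsPrime = r-prime All.∷ _ } =
  r , r-prime , subst (r ℕ.∣_) (≡.sym d≡r·∏rs) (ℕ.m∣m*n (product rs))

prime-if-factors-≥ : ∀ {N m} → 1 ℕ.< N → N ℕ.< m ℕ.* m → (∀ {r} → Prime r → r ℕ.∣ N → m ℕ.≤ r) → Prime N
prime-if-factors-≥ {N} {m} 1<N N<m² factors-≥ = rough∧square>⇒prime {{ℕ.n>1⇒nonTrivial 1<N}} rough N<m²
  where
  rough : m Rough N
  rough (hasNonTrivialDivisor {d} d<m d∣N) with r , r-prime , r∣d ← ∃-prime-factor (ℕ.nonTrivial⇒n>1 d) =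
    ℕ.<⇒≱ d<m (ℕ.≤-trans (factors-≥ r-prime (ℕ.∣-trans r∣d d∣N)) (ℕ.∣⇒≤ r∣d))
    where instance _ = ℕ.>-nonZero (ℕ.<-trans (ℕ.s≤s ℕ.z≤n) (ℕ.nonTrivial⇒n>1 d))

odd-prime-power : ∀ {p} → Prime p → p ≢ 2 → ∀ ℓ → ¬ 2 ℕ.∣ p ℕ.^ ℓ
odd-prime-power p-prime p≢2 zero 2∣1 = contradiction (ℕ.∣1⇒≡1 2∣1) λ ()
odd-prime-power {p} p-prime p≢2 (suc ℓ) 2∣pᶫ⁺¹ with euclidsLemma p (p ℕ.^ ℓ) prime[2] 2∣pᶫ⁺¹
... | inj₁ 2∣p = [ (λ ()) , p≢2 ∘ ≡.sym ]′ (prime⇒irreducible p-prime 2∣p)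
... | inj₂ 2∣pᶫ = odd-prime-power p-prime p≢2 ℓ 2∣pᶫ

odd-∣-double : ∀ {P m} → ¬ 2 ℕ.∣ P → P ℕ.∣ m ℕ.+ m → P ℕ.∣ m
odd-∣-double {P} {m} 2∤P P∣m+m = coprime-divisor P⊥2 (subst (P ℕ.∣_) (cong (m ℕ.+_) (≡.sym (ℕ.+-identityʳ m))) P∣m+m)
  where
  P⊥2 : Coprime P 2
  P⊥2 (d∣P , d∣2) = [ id , (λ d≡2 → contradiction (subst (ℕ._∣ P) d≡2 d∣P) 2∤P) ]′ (prime⇒irreducible prime[2] d∣2)

prime-power-≤ : ∀ {p h} → Prime p → p ≢ 2 → 0 ℕ.< h → ¬ p ℕ.∣ suc (h ℕ.+ h) → ∀ ℓ →
                p ℕ.^ suc ℓ ℕ.∣ suc (h ℕ.+ h) ℕ.+ suc (h ℕ.+ h) ⊎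
                p ℕ.^ suc ℓ ℕ.∣ h ℕ.+ h ⊎
                p ℕ.^ suc ℓ ℕ.∣ suc (suc (h ℕ.+ h)) →
                p ℕ.^ suc ℓ ℕ.≤ suc (h ℕ.+ h)
prime-power-≤ {p} {h} p-prime p≢2 0<h p∤q ℓ = [ flip contradiction P∤q+q , [ P∣h+h⇒ , P∣q+1⇒ ]′ ]′
  where
  P : ℕ
  P = p ℕ.^ suc ℓ
  2∤P : ¬ 2 ℕ.∣ P
  2∤P = odd-prime-power p-prime p≢2 (suc ℓ)
  P∤q+q : ¬ P ℕ.∣ suc (h ℕ.+ h) ℕ.+ suc (h ℕ.+ h)
  P∤q+q P∣q+q = p∤q (ℕ.∣-trans (ℕ.m∣m*n (p ℕ.^ ℓ)) (odd-∣-double 2∤P P∣q+q))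
  P∣h+h⇒ : P ℕ.∣ h ℕ.+ h → P ℕ.≤ suc (h ℕ.+ h)
  P∣h+h⇒ P∣h+h = ℕ.m≤n⇒m≤1+n (ℕ.≤-trans (ℕ.∣⇒≤ (odd-∣-double 2∤P P∣h+h)) (ℕ.m≤m+n h h))
    where instance _ = ℕ.>-nonZero 0<h
  P∣q+1⇒ : P ℕ.∣ suc (suc (h ℕ.+ h)) → P ℕ.≤ suc (h ℕ.+ h)
  P∣q+1⇒ P∣q+1 = ℕ.≤-trans (ℕ.∣⇒≤ (odd-∣-double 2∤P (subst (P ℕ.∣_) (cong suc (≡.sym (ℕ.+-suc h h))) P∣q+1)))
                           (ℕ.s≤s (ℕ.m≤m+n h h))

*-^-suc : ∀ u p ℓ → u ℕ.* p ℕ.^ ℓ ℕ.* p ≡ u ℕ.* p ℕ.^ suc ℓ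
*-^-suc u p ℓ = regroup u p (p ℕ.^ ℓ)
  where
  regroup : ∀ u p x → u ℕ.* x ℕ.* p ≡ u ℕ.* (p ℕ.* x)
  regroup = ℕ.solve-∀

odd-form : ∀ {n} → ¬ 2 ℕ.∣ n → ∃ λ h → n ≡ suc (h ℕ.+ h)
odd-form {zero} 2∤0 = contradiction (ℕ._∣0 2) 2∤0
odd-form {suc zero} _ = 0 , refl
odd-form {suc (suc n)} 2∤n+2 with h , refl ← odd-form (2∤n+2 ∘ ℕ.∣m∣n⇒∣m+n (ℕ.∣-refl {2})) =
  suc h , cong (λ n → suc (suc n)) (≡.sym (ℕ.+-suc h h))

-- Binomials, orders and geometric sums in commutative rings

module _ {c ℓ} (R : CommutativeSemiring c ℓ) where

  open CommutativeSemiring R hiding (zero; refl)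
  open import Algebra.Properties.CommutativeSemiring.Binomial R using (theorem; binomialTerm)
  open import Algebra.Properties.Semiring.Mult semiring using (×-assocˡ; ×-assoc-*; ×-congʳ) renaming (_×_ to _×ₘ_)
  open import Algebra.Properties.Semiring.Exp semiring using (_^_)
  open import Algebra.Properties.Monoid.Sum +-monoid using (sum; sum-cong-≋; sum-replicate-zero; sum-init-last)
  open import Relation.Binary.Reasoning.Setoid setoid

  multiple-of-char : ∀ {q k} → q ×ₘ 1# ≈ 0# → q ℕ.∣ k → ∀ x → k ×ₘ x ≈ 0#
  multiple-of-char {q} q×1≈0 (ℕ.divides c refl) x = begin
    (c ℕ.* q) ×ₘ x       ≡⟨ cong (_×ₘ x) (ℕ.*-comm c q) ⟩
    (q ℕ.* c) ×ₘ x       ≈⟨ ×-assocˡ x q c ⟨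
    q ×ₘ (c ×ₘ x)         ≈⟨ ×-congʳ q (*-identityˡ (c ×ₘ x)) ⟨
    q ×ₘ (1# * (c ×ₘ x))  ≈⟨ ×-assoc-* q 1# (c ×ₘ x) ⟨
    (q ×ₘ 1#) * (c ×ₘ x)  ≈⟨ *-congʳ q×1≈0 ⟩
    0# * (c ×ₘ x)        ≈⟨ zeroˡ (c ×ₘ x) ⟩
    0#                  ∎

  freshmans-dream : ∀ {q} → Prime q → q ×ₘ 1# ≈ 0# → ∀ x y → (x + y) ^ q ≈ x ^ q + y ^ q
  freshmans-dream {q@(suc m)} q-prime q×1≈0 x y = begin
    (x + y) ^ q                                  ≈⟨ theorem q x y ⟩
    head t + sum (tail t)                        ≈⟨ +-congˡ (sum-init-last (tail t)) ⟩
    head t + (sum (init (tail t)) + last (tail t)) ≈⟨ +-cong first (+-cong middle last≈) ⟩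
    y ^ q + (0# + x ^ q)                         ≈⟨ +-congˡ (+-identityˡ (x ^ q)) ⟩
    y ^ q + x ^ q                                ≈⟨ +-comm (y ^ q) (x ^ q) ⟩
    x ^ q + y ^ q                                ∎
    where
    t : Fin (suc q) → Carrier
    t = binomialTerm x y q
    first : head t ≈ y ^ q
    first = trans (+-identityʳ _) (*-identityˡ (y ^ q))
    term : ℕ → Carrier
    term k = (q C k) ×ₘ (x ^ k * y ^ (q ℕ.∸ k))
    middle : sum (init (tail t)) ≈ 0#
    middle = trans (sum-cong-≋ {x = init (tail t)} {y = λ _ → 0#} vanishes) (sum-replicate-zero m)
      where
      vanishes : ∀ j → term (suc (toℕ (inject₁ j))) ≈ 0#
      vanishes j = multiple-of-char q×1≈0 (prime∣C q-prime (ℕ.s≤s ℕ.z≤n) (ℕ.s≤s j<m)) _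
        where
        j<m : toℕ (inject₁ j) ℕ.< m
        j<m = subst (ℕ._< m) (≡.sym (Fin.toℕ-inject₁ j)) (Fin.toℕ<n j)
    last≈ : last (tail t) ≈ x ^ q
    last≈ = begin
      term (suc (toℕ (fromℕ m)))  ≡⟨ cong (term ∘ suc) (Fin.toℕ-fromℕ m) ⟩
      (q C q) ×ₘ (x ^ q * y ^ (q ℕ.∸ q)) ≡⟨ ≡.cong₂ (λ c e → c ×ₘ (x ^ q * y ^ e)) (nCn≡1 q) (ℕ.n∸n≡0 q) ⟩
      (x ^ q * 1#) + 0#           ≈⟨ +-identityʳ _ ⟩
      x ^ q * 1#                  ≈⟨ *-identityʳ (x ^ q) ⟩
      x ^ q                       ∎

module Powers {c ℓ} (R : CommutativeRing c ℓ) where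

  open CommutativeRing R hiding (refl; -_)
  open CommutativeRing R using () renaming (-_ to negate)
  open import Algebra.Properties.Semiring.Exp semiring using (_^_; ^-homo-*; ^-assocʳ; ^-congˡ; ^-congʳ)
  open import Algebra.Properties.Semiring.Mult semiring using () renaming (_×_ to _×ₘ_)
  open import Relation.Binary.Reasoning.Setoid setoid

  1^ : ∀ k → 1# ^ k ≈ 1#
  1^ zero = reflexive refl
  1^ (suc k) = trans (*-identityˡ (1# ^ k)) (1^ k)

  module _ {x : Carrier} where

    ^≈1-* : ∀ a k → x ^ a ≈ 1# → x ^ (a ℕ.* k) ≈ 1#
    ^≈1-* a k xᵃ≈1 = begin
      x ^ (a ℕ.* k)   ≈⟨ ^-assocʳ x a k ⟨
      (x ^ a) ^ k     ≈⟨ ^-congˡ k xᵃ≈1 ⟩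
      1# ^ k          ≈⟨ 1^ k ⟩
      1#              ∎

    ^≈1-∣ : ∀ {a b} → a ℕ.∣ b → x ^ a ≈ 1# → x ^ b ≈ 1#
    ^≈1-∣ {a} (ℕ.divides k refl) xᵃ≈1 = trans (^-congʳ x (ℕ.*-comm k a)) (^≈1-* a k xᵃ≈1)

    private
      ^≈1-∸ : ∀ d e → x ^ (d ℕ.+ e) ≈ 1# → x ^ e ≈ 1# → x ^ d ≈ 1#
      ^≈1-∸ d e xᵈ⁺ᵉ≈1 xᵉ≈1 = begin
        x ^ d            ≈⟨ *-identityʳ (x ^ d) ⟨
        x ^ d * 1#       ≈⟨ *-congˡ xᵉ≈1 ⟨
        x ^ d * x ^ e    ≈⟨ ^-homo-* x d e ⟨
        x ^ (d ℕ.+ e)    ≈⟨ xᵈ⁺ᵉ≈1 ⟩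
        1#               ∎

    ^≈1-gcd : ∀ a b → x ^ a ≈ 1# → x ^ b ≈ 1# → x ^ gcd a b ≈ 1#
    ^≈1-gcd a b xᵃ≈1 xᵇ≈1 with Bézout.identity (gcd-GCD a b)
    ... | Bézout.+- i j d+jb≡ia =
      ^≈1-∸ (gcd a b) (j ℕ.* b) (trans (^-congʳ x d+jb≡ia) (^≈1-∣ (ℕ.n∣m*n i) xᵃ≈1)) (^≈1-∣ (ℕ.n∣m*n j) xᵇ≈1)
    ... | Bézout.-+ i j d+ia≡jb =
      ^≈1-∸ (gcd a b) (i ℕ.* a) (trans (^-congʳ x d+ia≡jb) (^≈1-∣ (ℕ.n∣m*n j) xᵇ≈1)) (^≈1-∣ (ℕ.n∣m*n i) xᵃ≈1)

    -- g = gcd M (u·P) is a period of x, and if p divides u·P/g then g already divides u·P/p.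
    prime-power-order : ∀ {p} → Prime p → ∀ u ℓ {M} → x ^ (u ℕ.* p ℕ.^ suc ℓ) ≈ 1# →
                        ¬ x ^ (u ℕ.* p ℕ.^ ℓ) ≈ 1# → x ^ M ≈ 1# → p ℕ.^ suc ℓ ℕ.∣ M
    prime-power-order {p} p-prime u ℓ {M} xᵘᴾ≈1 xᵘᴾ/ᵖ≉1 xᴹ≈1 = by-cases (gcd[m,n]∣n M uP) (p ℕ.∣? _)
      where
      instance _ = prime⇒nonZero p-prime
      uP g : ℕ
      uP = u ℕ.* p ℕ.^ suc ℓ
      g = gcd M uP
      xᵍ≈1 : x ^ g ≈ 1#
      xᵍ≈1 = ^≈1-gcd M uP xᴹ≈1 xᵘᴾ≈1
      by-cases : (g∣uP : g ℕ.∣ uP) → Dec (p ℕ.∣ ℕ.quotient g∣uP) → p ℕ.^ suc ℓ ℕ.∣ M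
      by-cases (ℕ.divides c uP≡cg) (no p∤c) = ℕ.∣-trans (prime-power-∣-* p-prime (suc ℓ) p∤c P∣gc) (gcd[m,n]∣m M uP)
        where
        P∣gc : p ℕ.^ suc ℓ ℕ.∣ g ℕ.* c
        P∣gc = subst (p ℕ.^ suc ℓ ℕ.∣_) (≡.trans uP≡cg (ℕ.*-comm c g)) (ℕ.n∣m*n u)
      by-cases (ℕ.divides c uP≡cg) (yes (ℕ.divides c′ refl)) = contradiction (^≈1-∣ g∣uP/p xᵍ≈1) xᵘᴾ/ᵖ≉1
        where
        g∣uP/p : g ℕ.∣ u ℕ.* p ℕ.^ ℓ
        g∣uP/p = ℕ.divides c′ (ℕ.*-cancelʳ-≡ _ _ p (≡.trans (*-^-suc u p ℓ) (≡.trans uP≡cg (regroup c′ p g))))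
          where
          regroup : ∀ c p g → c ℕ.* p ℕ.* g ≡ c ℕ.* g ℕ.* p
          regroup = ℕ.solve-∀

  geometric : Carrier → ℕ → Carrier
  geometric x zero = 0#
  geometric x (suc p) = geometric x p + x ^ p

  geometric-cong : ∀ {x y} p → x ≈ y → geometric x p ≈ geometric y p
  geometric-cong zero _ = reflexive refl
  geometric-cong (suc p) x≈y = +-cong (geometric-cong p x≈y) (^-congˡ p x≈y)

  geometric-one : ∀ p → geometric 1# p ≈ p ×ₘ 1#
  geometric-one zero = reflexive refl
  geometric-one (suc p) = trans (+-cong (geometric-one p) (1^ p)) (+-comm (p ×ₘ 1#) 1#)

  geometric-* : ∀ x p → geometric x p * (x - 1#) + 1# ≈ x ^ p
  geometric-* x zero = trans (+-congʳ (zeroˡ (x - 1#))) (+-identityˡ 1#)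
  geometric-* x (suc p) = begin
    (g + a) * (x - 1#) + 1#        ≈⟨ +-congʳ (distribʳ (x - 1#) g a) ⟩
    (g * (x - 1#) + a * (x - 1#)) + 1#  ≈⟨ +-assoc _ _ _ ⟩
    g * (x - 1#) + (a * (x - 1#) + 1#)  ≈⟨ +-congˡ (+-comm _ 1#) ⟩
    g * (x - 1#) + (1# + a * (x - 1#))  ≈⟨ +-assoc _ _ _ ⟨
    (g * (x - 1#) + 1#) + a * (x - 1#)  ≈⟨ +-congʳ (geometric-* x p) ⟩
    a + a * (x - 1#)               ≈⟨ +-congʳ (*-identityʳ a) ⟨
    a * 1# + a * (x - 1#)          ≈⟨ distribˡ a 1# (x - 1#) ⟨
    a * (1# + (x - 1#))            ≈⟨ *-congˡ 1+[x-1]≈x ⟩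
    a * x                          ≈⟨ *-comm a x ⟩
    x * a                          ∎
    where
    g a : Carrier
    g = geometric x p
    a = x ^ p
    1+[x-1]≈x : 1# + (x - 1#) ≈ x
    1+[x-1]≈x = begin
      1# + (x - 1#)      ≈⟨ +-comm 1# (x - 1#) ⟩
      x - 1# + 1#        ≈⟨ +-assoc x (negate 1#) 1# ⟩
      x + (negate 1# + 1#) ≈⟨ +-congˡ (-‿inverseˡ 1#) ⟩
      x + 0#             ≈⟨ +-identityʳ x ⟩
      x                  ∎

-- Fermat, Wilson and Euler

record Pairing (n : ℕ) (c : ℤ) (σ : ℕ → ℕ) (S : List ℕ) : Set where
  field
    closed      : ∀ {x} → x ∈ S → σ x ∈ S
    no-fixpoint : ∀ {x} → x ∈ S → σ x ≢ x
    involutive  : ∀ {x} → x ∈ S → σ (σ x) ≡ x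
    pairs-to    : ∀ {x} → x ∈ S → + x ℤ.* + σ x ≈ c [mod n ]

partner-∈-tail : ∀ {n c σ x S} → Pairing n c σ (x ∷ S) → σ x ∈ S
partner-∈-tail P with Pairing.closed P (here refl)
... | here σx≡x = contradiction σx≡x (Pairing.no-fixpoint P (here refl))
... | there σx∈S = σx∈S

module RemovePair {n c σ x} A B (S-unique : Unique (x ∷ A ++ [ σ x ] ++ B)) (P : Pairing n c σ (x ∷ A ++ [ σ x ] ++ B)) where

  open Pairing P

  S↭ : x ∷ A ++ [ σ x ] ++ B ↭ x ∷ σ x ∷ A ++ B
  S↭ = ↭-prep x (shift (σ x) A B)

  private
    unique : Unique (x ∷ σ x ∷ A ++ B)
    unique = Unique-resp-↭ (↭⇒↭ₛ S↭) S-unique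
    x∉T : x ∉ A ++ B
    x∉T x∈T = All.lookup (All.tail (AllPairs.head unique)) x∈T refl
    σx∉T : σ x ∉ A ++ B
    σx∉T σx∈T = All.lookup (AllPairs.head (AllPairs.tail unique)) σx∈T refl
    ∈S : ∀ {z} → z ∈ A ++ B → z ∈ x ∷ A ++ [ σ x ] ++ B
    ∈S z∈T = ∈-resp-↭ (↭-sym S↭) (there (there z∈T))
    closed-T : ∀ {z} → z ∈ A ++ B → σ z ∈ A ++ B
    closed-T {z} z∈T with ∈-resp-↭ S↭ (closed (∈S z∈T))
    ... | here σz≡x = contradiction (subst (_∈ A ++ B) z≡σx z∈T) σx∉T
      where
      z≡σx : z ≡ σ x
      z≡σx = ≡.trans (≡.sym (involutive (∈S z∈T))) (cong σ σz≡x)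
    ... | there (here σz≡σx) = contradiction (subst (_∈ A ++ B) z≡x z∈T) x∉T
      where
      z≡x : z ≡ x
      z≡x = ≡.trans (≡.sym (involutive (∈S z∈T))) (≡.trans (cong σ σz≡σx) (involutive (here refl)))
    ... | there (there σz∈T) = σz∈T

  T-unique : Unique (A ++ B)
  T-unique = AllPairs.tail (AllPairs.tail unique)

  T-pairing : Pairing n c σ (A ++ B)
  T-pairing = record
    { closed = closed-T ; no-fixpoint = no-fixpoint ∘ ∈S ; involutive = involutive ∘ ∈S ; pairs-to = pairs-to ∘ ∈S }

pairing-product : ∀ {n c σ} k {S} → length S ≡ k ℕ.+ k → Unique S → Pairing n c σ S →
                  + product S ≈ c ℤ.^ k [mod n ]
pairing-product zero {[]} _ _ _ = ≈-refl
pairing-product {n} {c} {σ} (suc k) {x ∷ _} |S|≡ S-unique P with A , B , refl ← ∈-∃++ (partner-∈-tail P) =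
  ≈-trans (≈-reflexive product≡) (≈-*-cong (Pairing.pairs-to P (here refl)) (pairing-product k |T|≡ T-unique T-pairing))
  where
  open RemovePair A B S-unique P
  T : List ℕ
  T = A ++ B
  |T|≡ : length T ≡ k ℕ.+ k
  |T|≡ = ℕ.suc-injective (ℕ.suc-injective (≡.trans (≡.sym (↭-length S↭)) (≡.trans |S|≡ (cong suc (ℕ.+-suc k k)))))
  product≡ : + product (x ∷ A ++ [ σ x ] ++ B) ≡ + x ℤ.* + σ x ℤ.* + product T
  product≡ = begin
    + (x ℕ.* product (A ++ [ σ x ] ++ B))  ≡⟨ cong (λ p → + (x ℕ.* p)) (product-↭ (shift (σ x) A B)) ⟩
    + (x ℕ.* (σ x ℕ.* product T))           ≡⟨ cong +_ (ℕ.*-assoc x (σ x) (product T)) ⟨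
    + (x ℕ.* σ x ℕ.* product T)             ≡⟨ ℤ.pos-* (x ℕ.* σ x) (product T) ⟩
    + (x ℕ.* σ x) ℤ.* + product T           ≡⟨ cong (ℤ._* + product T) (ℤ.pos-* x (σ x)) ⟩
    + x ℤ.* + σ x ℤ.* + product T           ∎
    where open ≡.≡-Reasoning

range : ℕ → ℕ → List ℕ
range a n = applyUpTo (a ℕ.+_) n

range-unique : ∀ a n → Unique (range a n)
range-unique a n = applyUpTo⁺₁ (a ℕ.+_) n (λ i<j _ → ℕ.<⇒≢ (ℕ.+-monoʳ-< a i<j))

∈-range⁻ : ∀ {a n x} → x ∈ range a n → a ℕ.≤ x × x ℕ.< a ℕ.+ n
∈-range⁻ {a} x∈ with i , i<n , refl ← ∈-applyUpTo⁻ (a ℕ.+_) x∈ = ℕ.m≤m+n a i , ℕ.+-monoʳ-< a i<n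

∈-range⁺ : ∀ {a n x} → a ℕ.≤ x → x ℕ.< a ℕ.+ n → x ∈ range a n
∈-range⁺ {a} {n} {x} a≤x x<a+n = subst (_∈ range a n) (ℕ.m+[n∸m]≡n a≤x) (∈-applyUpTo⁺ (a ℕ.+_) x∸a<n)
  where
  x∸a<n : x ℕ.∸ a ℕ.< n
  x∸a<n = subst (x ℕ.∸ a ℕ.<_) (ℕ.m+n∸m≡n a n) (ℕ.∸-monoˡ-< x<a+n a≤x)

module ModPrime {m : ℕ} (q-prime : Prime (suc m)) where

  q : ℕ
  q = suc m

  open CommutativeRing (ℤ/ q) using (commutativeSemiring; semiring; setoid)
  open import Relation.Binary.Reasoning.Setoid setoid
  open import Algebra.Properties.Semiring.Mult semiring using () renaming (_×_ to _×ₘ_)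
  open import Algebra.Properties.Semiring.Exp semiring renaming (_^_ to _^ᴿ_)

  private
    ^ᴿ≡^ : ∀ x k → x ^ᴿ k ≡ x ℤ.^ k
    ^ᴿ≡^ x zero = refl
    ^ᴿ≡^ x (suc k) = cong (x ℤ.*_) (^ᴿ≡^ x k)

    ×1≡ : ∀ k → k ×ₘ 1ℤ ≡ + k
    ×1≡ zero = refl
    ×1≡ (suc k) = ≡.trans (cong (λ z → 1ℤ ℤ.+ z) (×1≡ k)) (≡.sym (ℤ.pos-+ 1 k))

    freshman : ∀ x y → (x ℤ.+ y) ℤ.^ q ≈ x ℤ.^ q ℤ.+ y ℤ.^ q [mod q ]
    freshman x y = begin
      (x ℤ.+ y) ℤ.^ q         ≡⟨ ^ᴿ≡^ (x ℤ.+ y) q ⟨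
      (x ℤ.+ y) ^ᴿ q          ≈⟨ freshmans-dream commutativeSemiring q-prime q×1≈0 x y ⟩
      x ^ᴿ q ℤ.+ y ^ᴿ q       ≡⟨ ≡.cong₂ ℤ._+_ (^ᴿ≡^ x q) (^ᴿ≡^ y q) ⟩
      x ℤ.^ q ℤ.+ y ℤ.^ q     ∎
      where q×1≈0 = ≈-trans (≈-reflexive (×1≡ q)) n≈0

    instance _ = prime⇒nonZero q-prime

    fermat-ℕ : ∀ k → (+ k) ℤ.^ q ≈ + k [mod q ]
    fermat-ℕ zero = ≈-reflexive (ℤ.*-zeroˡ (0ℤ ℤ.^ m))
    fermat-ℕ (suc k) = begin
      (+ suc k) ℤ.^ q             ≡⟨ cong (ℤ._^ q) (ℤ.pos-+ 1 k) ⟩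
      (1ℤ ℤ.+ + k) ℤ.^ q          ≈⟨ freshman 1ℤ (+ k) ⟩
      1ℤ ℤ.^ q ℤ.+ (+ k) ℤ.^ q    ≈⟨ ≈-+-cong (≈-reflexive (ℤ.^-zeroˡ q)) (fermat-ℕ k) ⟩
      1ℤ ℤ.+ + k                  ≡⟨ ℤ.pos-+ 1 k ⟨
      + suc k                     ∎

  fermat : ∀ a → a ℤ.^ q ≈ a [mod q ]
  fermat a = begin
    a ℤ.^ q      ≈⟨ ≈-^-cong q (≈-%ℕ a) ⟩
    (+ r) ℤ.^ q  ≈⟨ fermat-ℕ r ⟩
    + r          ≈⟨ ≈-%ℕ a ⟨
    a            ∎
    where
    r : ℕ
    r = a ℤ.%ℕ q

  fermat-unit : ∀ {a} → ¬ a ≈ 0ℤ [mod q ] → a ℤ.^ m ≈ 1ℤ [mod q ]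
  fermat-unit {a} a≉0 = [ flip contradiction a≉0 , x-y≈0⇒x≈y ]′ (prime-≈0-* q-prime a[a^m-1]≈0)
    where
    a[a^m-1]≈0 : a ℤ.* (a ℤ.^ m ℤ.- 1ℤ) ≈ 0ℤ [mod q ]
    a[a^m-1]≈0 = ≈-trans (≈-reflexive (distrib a (a ℤ.^ m))) (x≈y⇒x-y≈0 (fermat a))
      where
      distrib : ∀ a b → a ℤ.* (b ℤ.- 1ℤ) ≡ a ℤ.* b ℤ.- a
      distrib = solve-∀

  square≈1 : ∀ {a} → a ℤ.* a ≈ 1ℤ [mod q ] → a ≈ 1ℤ [mod q ] ⊎ a ≈ - 1ℤ [mod q ]
  square≈1 {a} a²≈1 = Data.Sum.map x-y≈0⇒x≈y x-y≈0⇒x≈y (prime-≈0-* q-prime [a-1][a+1]≈0)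
    where
    factor : ∀ a → (a ℤ.- 1ℤ) ℤ.* (a ℤ.- - 1ℤ) ≡ a ℤ.* a ℤ.- 1ℤ
    factor = solve-∀
    [a-1][a+1]≈0 : (a ℤ.- 1ℤ) ℤ.* (a ℤ.- - 1ℤ) ≈ 0ℤ [mod q ]
    [a-1][a+1]≈0 = ≈-trans (≈-reflexive (factor a)) (x≈y⇒x-y≈0 a²≈1)


  +≉0 : ∀ {x} → 0 ℕ.< x → x ℕ.< q → ¬ + x ≈ 0ℤ [mod q ]
  +≉0 {suc x} _ x<q x≈0 = ℕ.<⇒≱ x<q (ℕ.∣⇒≤ (≈0⇒∣ x≈0))

  m≈-1 : + m ≈ - 1ℤ [mod q ]
  m≈-1 = mk≈ (divides 1ℤ (≡.trans (add-one (+ m)) (cong (1ℤ ℤ.*_) (≡.sym (ℤ.pos-+ 1 m)))))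
    where
    add-one : ∀ x → x ℤ.- - 1ℤ ≡ 1ℤ ℤ.* (1ℤ ℤ.+ x)
    add-one = solve-∀

  *-cancelˡ-≈ : ∀ {a x y} → ¬ a ≈ 0ℤ [mod q ] → a ℤ.* x ≈ a ℤ.* y [mod q ] → x ≈ y [mod q ]
  *-cancelˡ-≈ {a} {x} {y} a≉0 ax≈ay = [ flip contradiction a≉0 , x-y≈0⇒x≈y ]′ (prime-≈0-* q-prime a[x-y]≈0)
    where
    distrib : ∀ a x y → a ℤ.* (x ℤ.- y) ≡ a ℤ.* x ℤ.- a ℤ.* y
    distrib = solve-∀
    a[x-y]≈0 : a ℤ.* (x ℤ.- y) ≈ 0ℤ [mod q ]
    a[x-y]≈0 = ≈-trans (≈-reflexive (distrib a x y)) (x≈y⇒x-y≈0 ax≈ay)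

  inverse : ℤ → ℤ
  inverse a = a ℤ.^ ℕ.pred m

  inverse-* : ∀ {a} → ¬ a ≈ 0ℤ [mod q ] → a ℤ.* inverse a ≈ 1ℤ [mod q ]
  inverse-* {a} a≉0 = ≈-trans (≈-reflexive (cong (a ℤ.^_) (ℕ.suc-pred m))) (fermat-unit a≉0)
    where instance _ = ℕ.>-nonZero (ℕ.≤-pred (prime>1 q-prime))

module OddPrime {h : ℕ} (q-prime : Prime (suc (h ℕ.+ h))) where

  open ModPrime q-prime

  private
    instance _ = prime⇒nonZero q-prime
    m : ℕ
    m = h ℕ.+ h

  instance
    h-nonZero : ℕ.NonZero h
    h-nonZero = half-nonZero (prime>1 q-prime)
      where
      half-nonZero : ∀ {h} → 1 ℕ.< suc (h ℕ.+ h) → ℕ.NonZero h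
      half-nonZero {zero} (ℕ.s≤s ())
      half-nonZero {suc _} _ = _

  half : ℤ
  half = + suc h

  half-* : half ℤ.* + 2 ≈ 1ℤ [mod q ]
  half-* = mk≈ (divides 1ℤ (begin
    + suc h ℤ.* + 2 ℤ.- 1ℤ            ≡⟨ cong (λ x → x ℤ.* + 2 ℤ.- 1ℤ) (ℤ.pos-+ 1 h) ⟩
    (1ℤ ℤ.+ + h) ℤ.* + 2 ℤ.- 1ℤ       ≡⟨ double (+ h) ⟩
    1ℤ ℤ.* (1ℤ ℤ.+ (+ h ℤ.+ + h))     ≡⟨ cong (λ x → 1ℤ ℤ.* (1ℤ ℤ.+ x)) (ℤ.pos-+ h h) ⟨
    1ℤ ℤ.* (1ℤ ℤ.+ + (h ℕ.+ h))       ≡⟨ cong (1ℤ ℤ.*_) (ℤ.pos-+ 1 (h ℕ.+ h)) ⟨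
    1ℤ ℤ.* + q                        ∎))
    where
    open ≡.≡-Reasoning
    double : ∀ x → (1ℤ ℤ.+ x) ℤ.* + 2 ℤ.- 1ℤ ≡ 1ℤ ℤ.* (1ℤ ℤ.+ (x ℤ.+ x))
    double = solve-∀

  2≉0 : ¬ + 2 ≈ 0ℤ [mod q ]
  2≉0 2≈0 = +≉0 (ℕ.s≤s ℕ.z≤n) (prime>1 q-prime)
    (≈-trans (≈-sym half-*) (≈-trans (≈-*-cong (≈-refl {x = half}) 2≈0) (≈-reflexive (ℤ.*-zeroʳ half))))

  -- σ x is the y < q with x·y ≡ c.  For a non-residue c it splits 1, …, q - 1 into pairs of product c
  -- (Dirichlet), and for c = 1 it splits 2, …, q - 2 into pairs of product 1 (Wilson).
  module Cofactor (c : ℤ) (c≉0 : ¬ c ≈ 0ℤ [mod q ]) where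

    σ : ℕ → ℕ
    σ x = (c ℤ.* inverse (+ x)) ℤ.%ℕ q

    σ<q : ∀ x → σ x ℕ.< q
    σ<q x = ℤ.n%ℕd<d (c ℤ.* inverse (+ x)) q

    σ-pairs : ∀ {x} → 0 ℕ.< x → x ℕ.< q → + x ℤ.* + σ x ≈ c [mod q ]
    σ-pairs {x} 0<x x<q = begin
      + x ℤ.* + σ x                  ≈⟨ ≈-*-cong (≈-refl {x = + x}) (≈-%ℕ (c ℤ.* inverse (+ x))) ⟨
      + x ℤ.* (c ℤ.* inverse (+ x))  ≡⟨ swap (+ x) c (inverse (+ x)) ⟩
      c ℤ.* (+ x ℤ.* inverse (+ x))  ≈⟨ ≈-*-cong (≈-refl {x = c}) (inverse-* (+≉0 0<x x<q)) ⟩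
      c ℤ.* 1ℤ                       ≡⟨ ℤ.*-identityʳ c ⟩
      c                              ∎
      where
      open import Relation.Binary.Reasoning.Setoid (CommutativeRing.setoid (ℤ/ q))
      swap : ∀ x c y → x ℤ.* (c ℤ.* y) ≡ c ℤ.* (x ℤ.* y)
      swap = solve-∀

    σ-positive : ∀ {x} → 0 ℕ.< x → x ℕ.< q → 0 ℕ.< σ x
    σ-positive {x} 0<x x<q = ℕ.n≢0⇒n>0 λ σx≡0 →
      c≉0 (≈-trans (≈-sym (σ-pairs 0<x x<q))
                   (≈-reflexive (≡.trans (cong (λ y → + x ℤ.* + y) σx≡0) (ℤ.*-zeroʳ (+ x)))))

    σ-involutive : ∀ {x} → 0 ℕ.< x → x ℕ.< q → σ (σ x) ≡ x
    σ-involutive {x} 0<x x<q = ≈-< (σ<q (σ x)) x<q (*-cancelˡ-≈ (+≉0 σx>0 (σ<q x)) σx·σσx≈σx·x)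
      where
      σx>0 : 0 ℕ.< σ x
      σx>0 = σ-positive 0<x x<q
      σx·σσx≈σx·x : + σ x ℤ.* + σ (σ x) ≈ + σ x ℤ.* + x [mod q ]
      σx·σσx≈σx·x = ≈-trans (σ-pairs σx>0 (σ<q x))
                      (≈-trans (≈-sym (σ-pairs 0<x x<q)) (≈-reflexive (ℤ.*-comm (+ x) (+ σ x))))

  units : List ℕ
  units = range 1 m

  private
    module Wilson where

      open Cofactor 1ℤ (+≉0 (ℕ.s≤s ℕ.z≤n) (prime>1 q-prime))

      k : ℕ
      k = ℕ.pred h

      m≡2+k+k : m ≡ 2 ℕ.+ (k ℕ.+ k)
      m≡2+k+k = ≡.trans (≡.cong₂ ℕ._+_ (≡.sym (ℕ.suc-pred h)) (≡.sym (ℕ.suc-pred h))) (cong suc (ℕ.+-suc k k))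

      middle : List ℕ
      middle = range 2 (k ℕ.+ k)

      units≡ : units ≡ 1 ∷ middle ∷ʳ m
      units≡ = begin
        range 1 m                         ≡⟨ cong (range 1) m≡2+k+k ⟩
        1 ∷ range 2 (suc (k ℕ.+ k))       ≡⟨ cong (1 ∷_) (applyUpTo-∷ʳ (2 ℕ.+_) (k ℕ.+ k)) ⟨
        1 ∷ middle ∷ʳ (2 ℕ.+ (k ℕ.+ k))   ≡⟨ cong (λ z → 1 ∷ middle ∷ʳ z) m≡2+k+k ⟨
        1 ∷ middle ∷ʳ m                   ∎
        where open ≡.≡-Reasoning

      ≈1⇒≡1 : ∀ {x} → x ℕ.< q → + x ≈ 1ℤ [mod q ] → x ≡ 1
      ≈1⇒≡1 x<q = ≈-< x<q (prime>1 q-prime)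

      ≈-1⇒≡m : ∀ {x} → x ℕ.< q → + x ≈ - 1ℤ [mod q ] → x ≡ m
      ≈-1⇒≡m x<q x≈-1 = ≈-< x<q (ℕ.n<1+n m) (≈-trans x≈-1 (≈-sym m≈-1))

      bounds : ∀ {x} → x ∈ middle → 2 ℕ.≤ x × x ℕ.< m × 0 ℕ.< x × x ℕ.< q
      bounds {x} x∈ = 2≤x , x<m , ℕ.<⇒≤ 2≤x , ℕ.m<n⇒m<1+n x<m
        where
        2≤x : 2 ℕ.≤ x
        2≤x = proj₁ (∈-range⁻ x∈)
        x<m : x ℕ.< m
        x<m = subst (x ℕ.<_) (≡.sym m≡2+k+k) (proj₂ (∈-range⁻ x∈))

      σx≢1 : ∀ {x} → 2 ℕ.≤ x → x ℕ.< q → σ x ≢ 1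
      σx≢1 {x} 2≤x x<q σx≡1 = ℕ.<⇒≢ 2≤x (≡.sym (≈1⇒≡1 x<q x≈1))
        where
        x≈1 : + x ≈ 1ℤ [mod q ]
        x≈1 = ≈-trans (≈-reflexive (≡.trans (≡.sym (ℤ.*-identityʳ (+ x))) (cong (λ y → + x ℤ.* + y) (≡.sym σx≡1))))
                      (σ-pairs (ℕ.<⇒≤ 2≤x) x<q)

      σx≢m : ∀ {x} → x ℕ.< m → 0 ℕ.< x → x ℕ.< q → σ x ≢ m
      σx≢m {x} x<m 0<x x<q σx≡m = ℕ.<⇒≢ x<m (≈-1⇒≡m x<q x≈-1)
        where
        x·m≈1 : + x ℤ.* + m ≈ 1ℤ [mod q ]
        x·m≈1 = subst (λ y → + x ℤ.* + y ≈ 1ℤ [mod q ]) σx≡m (σ-pairs 0<x x<q)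
        negate : ∀ x → x ≡ - (x ℤ.* - 1ℤ)
        negate = solve-∀
        x≈-1 : + x ≈ - 1ℤ [mod q ]
        x≈-1 = ≈-trans (≈-reflexive (negate (+ x)))
                 (≈-neg-cong (≈-trans (≈-*-cong (≈-refl {x = + x}) (≈-sym m≈-1)) x·m≈1))

      middle-pairing : Pairing q 1ℤ σ middle
      middle-pairing = record
        { closed = λ {x} x∈ → let 2≤x , x<m , 0<x , x<q = bounds x∈ in
            ∈-range⁺ (ℕ.≤∧≢⇒< (σ-positive 0<x x<q) (σx≢1 2≤x x<q ∘ ≡.sym))
                     (subst (σ x ℕ.<_) m≡2+k+k (ℕ.≤∧≢⇒< (ℕ.≤-pred (σ<q x)) (σx≢m x<m 0<x x<q)))
        ; no-fixpoint = λ {x} x∈ σx≡x → let 2≤x , x<m , 0<x , x<q = bounds x∈ in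
            [ ℕ.<⇒≢ 2≤x ∘ ≡.sym ∘ ≈1⇒≡1 x<q , ℕ.<⇒≢ x<m ∘ ≈-1⇒≡m x<q ]′
              (square≈1 (subst (λ y → + x ℤ.* + y ≈ 1ℤ [mod q ]) σx≡x (σ-pairs 0<x x<q)))
        ; involutive = λ x∈ → let _ , _ , 0<x , x<q = bounds x∈ in σ-involutive 0<x x<q
        ; pairs-to = λ x∈ → let _ , _ , 0<x , x<q = bounds x∈ in σ-pairs 0<x x<q }

      middle≈1 : + product middle ≈ 1ℤ [mod q ]
      middle≈1 = ≈-trans (pairing-product k (length-applyUpTo (2 ℕ.+_) (k ℕ.+ k)) (range-unique 2 _) middle-pairing)
                         (≈-reflexive (ℤ.^-zeroˡ k))

  wilson : + product units ≈ - 1ℤ [mod q ]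
  wilson = begin
    + product units                          ≡⟨ cong (+_ ∘ product) units≡ ⟩
    + (1 ℕ.* product (middle ++ [ m ]))      ≡⟨ cong +_ (≡.trans (ℕ.*-identityˡ _) (product-++ middle [ m ])) ⟩
    + (product middle ℕ.* (m ℕ.* 1))         ≡⟨ ℤ.pos-* (product middle) (m ℕ.* 1) ⟩
    + product middle ℤ.* + (m ℕ.* 1)         ≈⟨ ≈-*-cong middle≈1 (≈-reflexive (cong +_ (ℕ.*-identityʳ m))) ⟩
    1ℤ ℤ.* + m                               ≈⟨ ≈-*-cong (≈-refl {x = 1ℤ}) m≈-1 ⟩
    - 1ℤ                                     ∎
    where
    open Wilson using (middle; units≡; middle≈1)
    open import Relation.Binary.Reasoning.Setoid (CommutativeRing.setoid (ℤ/ q))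

  euler-nonresidue : ∀ {c} → (∀ y → ¬ y ℤ.* y ≈ c [mod q ]) → c ℤ.^ h ≈ - 1ℤ [mod q ]
  euler-nonresidue {c} nonsquare =
    ≈-trans (≈-sym (pairing-product h (length-applyUpTo (1 ℕ.+_) m) (range-unique 1 m) units-pairing)) wilson
    where
    open Cofactor c (λ c≈0 → nonsquare 0ℤ (≈-sym c≈0))
    units-pairing : Pairing q c σ units
    units-pairing = record
      { closed = λ x∈ → let 0<x , x<q = ∈-range⁻ x∈ in ∈-range⁺ (σ-positive 0<x x<q) (σ<q _)
      ; no-fixpoint = λ {x} x∈ σx≡x → let 0<x , x<q = ∈-range⁻ x∈ in
          nonsquare (+ x) (subst (λ y → + x ℤ.* + y ≈ c [mod q ]) σx≡x (σ-pairs 0<x x<q))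
      ; involutive = λ x∈ → let 0<x , x<q = ∈-range⁻ x∈ in σ-involutive 0<x x<q
      ; pairs-to = λ x∈ → let 0<x , x<q = ∈-range⁻ x∈ in σ-pairs 0<x x<q }

-- The rings ℤ[θ]/n

infix 4 _≈I_[mod_]
infixr 4 _&_

record _≈I_[mod_] (u v : Elt) (n : ℕ) : Set where
  constructor _&_
  field
    ≈₁ : proj₁ u ≈ proj₁ v [mod n ]
    ≈₂ : proj₂ u ≈ proj₂ v [mod n ]

module _ {n : ℕ} where

  ≈I-isEquivalence : IsEquivalence (λ u v → u ≈I v [mod n ])
  ≈I-isEquivalence = record
    { refl = ≈-refl & ≈-refl
    ; sym = λ (p & q) → ≈-sym p & ≈-sym q
    ; trans = λ (p & q) (p′ & q′) → ≈-trans p p′ & ≈-trans q q′ }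

  addI-cong : Congruent₂ (λ u v → u ≈I v [mod n ]) addI
  addI-cong (p & q) (p′ & q′) = ≈-+-cong p p′ & ≈-+-cong q q′

  ≈I⇒≡I : ∀ {u v} → u ≈I v [mod n ] → u ≡I v [mod n ]
  ≈I⇒≡I (p & q) = ≈⇒≡ᵢ p , ≈⇒≡ᵢ q

  ≡I⇒≈I : ∀ {u v} → u ≡I v [mod n ] → u ≈I v [mod n ]
  ≡I⇒≈I (p , q) = ≡ᵢ⇒≈ p & ≡ᵢ⇒≈ q

  ≈I-weaken : ∀ {m u v} → m ℕ.∣ n → u ≈I v [mod n ] → u ≈I v [mod m ]
  ≈I-weaken m∣n (p & q) = ≈-weaken m∣n p & ≈-weaken m∣n q

-- (a , b) is a + bθ with θ² = sθ + t;
-- ℤ[√D] is s = 0, t = D, and ℤ[(1 + √D)/2] is s = 1, t = (D - 1)/4.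
module Quadratic (s t : ℤ) where

  open import Data.Integer using (_+_; _*_; _-_)

  infixl 7 _·_
  _·_ : Op₂ Elt
  (a , b) · (c , d) = (a * c + t * b * d , a * d + b * c + s * b * d)

  negI : Op₁ Elt
  negI (a , b) = (- a , - b)

  private
    ·-assoc : ∀ u v w → (u · v) · w ≡ u · (v · w)
    ·-assoc (a , b) (c , d) (e , f) = ≡.cong₂ _,_ (first a b c d e f s t) (second a b c d e f s t)
      where
      first : ∀ a b c d e f s t →
        (a * c + t * b * d) * e + t * (a * d + b * c + s * b * d) * f ≡
        a * (c * e + t * d * f) + t * b * (c * f + d * e + s * d * f)
      first = solve-∀
      second : ∀ a b c d e f s t →
        (a * c + t * b * d) * f + (a * d + b * c + s * b * d) * e + s * (a * d + b * c + s * b * d) * f ≡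
        a * (c * f + d * e + s * d * f) + b * (c * e + t * d * f) + s * b * (c * f + d * e + s * d * f)
      second = solve-∀

    ·-comm : ∀ u v → u · v ≡ v · u
    ·-comm (a , b) (c , d) = ≡.cong₂ _,_ (first a b c d t) (second a b c d s)
      where
      first : ∀ a b c d t → a * c + t * b * d ≡ c * a + t * d * b
      first = solve-∀
      second : ∀ a b c d s → a * d + b * c + s * b * d ≡ c * b + d * a + s * d * b
      second = solve-∀

    ·-identityˡ : ∀ u → oneI · u ≡ u
    ·-identityˡ (a , b) = ≡.cong₂ _,_ (first a b t) (second a b s)
      where
      first : ∀ a b t → 1ℤ * a + t * 0ℤ * b ≡ a
      first = solve-∀
      second : ∀ a b s → 1ℤ * b + 0ℤ * a + s * 0ℤ * b ≡ b
      second = solve-∀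

    ·-distribʳ : ∀ u v w → addI v w · u ≡ addI (v · u) (w · u)
    ·-distribʳ (a , b) (c , d) (e , f) = ≡.cong₂ _,_ (first a b c d e f t) (second a b c d e f s)
      where
      first : ∀ a b c d e f t → (c + e) * a + t * (d + f) * b ≡ c * a + t * d * b + (e * a + t * f * b)
      first = solve-∀
      second : ∀ a b c d e f s →
        (c + e) * b + (d + f) * a + s * (d + f) * b ≡ c * b + d * a + s * d * b + (e * b + f * a + s * f * b)
      second = solve-∀

    ·-distribˡ : ∀ u v w → u · addI v w ≡ addI (u · v) (u · w)
    ·-distribˡ u v w = ≡.trans (·-comm u (addI v w)) (≡.trans (·-distribʳ u v w) (≡.cong₂ addI (·-comm v u) (·-comm w u)))

  negI-cong : ∀ {n} → Congruent₁ (λ u v → u ≈I v [mod n ]) negI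
  negI-cong (p & q) = ≈-neg-cong p & ≈-neg-cong q

  ·-cong : ∀ {n} → Congruent₂ (λ u v → u ≈I v [mod n ]) _·_
  ·-cong (p & q) (p′ & q′) =
    ≈-+-cong (≈-*-cong p p′) (≈-*-cong (≈-*-cong (≈-refl {x = t}) q) q′) &
    ≈-+-cong (≈-+-cong (≈-*-cong p q′) (≈-*-cong q p′)) (≈-*-cong (≈-*-cong (≈-refl {x = s}) q) q′)


  isCommutativeRing : IsCommutativeRing _≡_ addI _·_ negI zeroI oneI
  isCommutativeRing = record
    { isRing = record
      { +-isAbelianGroup = record
        { isGroup = record
          { isMonoid = record
            { isSemigroup = record
              { isMagma = record { isEquivalence = ≡.isEquivalence ; ∙-cong = ≡.cong₂ addI }
              ; assoc = λ (a , b) (c , d) (e , f) → ≡.cong₂ _,_ (ℤ.+-assoc a c e) (ℤ.+-assoc b d f) }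
            ; identity = (λ (a , b) → ≡.cong₂ _,_ (ℤ.+-identityˡ a) (ℤ.+-identityˡ b))
                       , (λ (a , b) → ≡.cong₂ _,_ (ℤ.+-identityʳ a) (ℤ.+-identityʳ b)) }
          ; inverse = (λ (a , b) → ≡.cong₂ _,_ (ℤ.+-inverseˡ a) (ℤ.+-inverseˡ b))
                    , (λ (a , b) → ≡.cong₂ _,_ (ℤ.+-inverseʳ a) (ℤ.+-inverseʳ b))
          ; ⁻¹-cong = ≡.cong negI }
        ; comm = λ (a , b) (c , d) → ≡.cong₂ _,_ (ℤ.+-comm a c) (ℤ.+-comm b d) }
      ; *-cong = ≡.cong₂ _·_
      ; *-assoc = ·-assoc
      ; *-identity = ·-identityˡ , λ u → ≡.trans (·-comm u oneI) (·-identityˡ u)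
      ; distrib = ·-distribˡ , ·-distribʳ }
    ; *-comm = ·-comm }

  ℤ[θ]/_ : ℕ → CommutativeRing 0ℓ 0ℓ
  ℤ[θ]/ n = record
    { isCommutativeRing = congruence⇒isCommutativeRing isCommutativeRing
        (≈I-isEquivalence {n}) addI-cong ·-cong negI-cong }

  ι : ℤ → Elt
  ι a = (a , 0ℤ)

  conj : Elt → Elt
  conj (a , b) = (a + s * b , - b)

  norm : Elt → ℤ
  norm (a , b) = a * a + s * a * b - t * b * b

  Δ : ℤ
  Δ = s * s + + 4 * t

  δ : Elt
  δ = (- s , + 2)

  ι-· : ∀ a b → ι a · ι b ≡ ι (a * b)
  ι-· a b = ≡.cong₂ _,_ (first a b t) (second a b s)
    where
    first : ∀ a b t → a * b + t * 0ℤ * 0ℤ ≡ a * b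
    first = solve-∀
    second : ∀ a b s → a * 0ℤ + 0ℤ * b + s * 0ℤ * 0ℤ ≡ 0ℤ
    second = solve-∀

  conj-·-self : ∀ u → conj u · u ≡ ι (norm u)
  conj-·-self (a , b) = ≡.cong₂ _,_ (first a b s t) (second a b s)
    where
    first : ∀ a b s t → (a + s * b) * a + t * - b * b ≡ a * a + s * a * b - t * b * b
    first = solve-∀
    second : ∀ a b s → (a + s * b) * b + - b * a + s * - b * b ≡ 0ℤ
    second = solve-∀

  norm-· : ∀ u v → norm (u · v) ≡ norm u * norm v
  norm-· (a , b) (c , d) = multiplicative a b c d s t
    where
    multiplicative : ∀ a b c d s t →
      (a * c + t * b * d) * (a * c + t * b * d) + s * (a * c + t * b * d) * (a * d + b * c + s * b * d)
        - t * (a * d + b * c + s * b * d) * (a * d + b * c + s * b * d) ≡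
      (a * a + s * a * b - t * b * b) * (c * c + s * c * d - t * d * d)
    multiplicative = solve-∀

  δ·δ : δ · δ ≡ ι Δ
  δ·δ = ≡.cong₂ _,_ (first s t) (second s)
    where
    first : ∀ s t → - s * - s + t * + 2 * + 2 ≡ s * s + + 4 * t
    first = solve-∀
    second : ∀ s → - s * + 2 + + 2 * - s + s * + 2 * + 2 ≡ 0ℤ
    second = solve-∀

  twice : ∀ a b → ι (+ 2) · (a , b) ≡ addI (ι (+ 2 * a + s * b)) (ι b · δ)
  twice a b = ≡.cong₂ _,_ (first a b s t) (second a b s)
    where
    first : ∀ a b s t → + 2 * a + t * 0ℤ * b ≡ + 2 * a + s * b + (b * - s + t * 0ℤ * + 2)
    first = solve-∀
    second : ∀ a b s → + 2 * b + 0ℤ * a + s * 0ℤ * b ≡ 0ℤ + (b * + 2 + 0ℤ * - s + s * 0ℤ * + 2)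
    second = solve-∀

  twice-conj : ∀ a b → ι (+ 2) · conj (a , b) ≡ addI (ι (+ 2 * a + s * b)) (ι (- b) · δ)
  twice-conj a b = ≡.cong₂ _,_ (first a b s t) (second a b s)
    where
    first : ∀ a b s t → + 2 * (a + s * b) + t * 0ℤ * - b ≡ + 2 * a + s * b + (- b * - s + t * 0ℤ * + 2)
    first = solve-∀
    second : ∀ a b s → + 2 * - b + 0ℤ * (a + s * b) + s * 0ℤ * - b ≡ 0ℤ + (- b * + 2 + 0ℤ * - s + s * 0ℤ * + 2)
    second = solve-∀

  square-identity : ∀ a b → (+ 2 * a + s * b) * (+ 2 * a + s * b) ≡ + 4 * norm (a , b) + Δ * b * b
  square-identity a b = complete-square a b s t
    where
    complete-square : ∀ a b s t →
      (+ 2 * a + s * b) * (+ 2 * a + s * b) ≡ + 4 * (a * a + s * a * b - t * b * b) + (s * s + + 4 * t) * b * b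
    complete-square = solve-∀

  norm-ι : ∀ a → norm (ι a) ≡ a * a
  norm-ι a = scalar a s t
    where
    scalar : ∀ a s t → a * a + s * a * 0ℤ - t * 0ℤ * 0ℤ ≡ a * a
    scalar = solve-∀

  module _ {n : ℕ} where

    ι-cong : ∀ {a b} → a ≈ b [mod n ] → ι a ≈I ι b [mod n ]
    ι-cong a≈b = a≈b & ≈-refl

    norm-cong : ∀ {u v} → u ≈I v [mod n ] → norm u ≈ norm v [mod n ]
    norm-cong (a≈c & b≈d) =
      ≈-+-cong (≈-+-cong (≈-*-cong a≈c a≈c) (≈-*-cong (≈-*-cong (≈-refl {x = s}) a≈c) b≈d))
               (≈-neg-cong (≈-*-cong (≈-*-cong (≈-refl {x = t}) b≈d) b≈d))

  -- With δ = 2θ - s, so δ² = Δ, the Frobenius fixes ℤ/q and sends δ to e·δ, where e = Δ^h is 0 or ±1;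
  -- e = -1 (Δ a non-residue) makes it conjugation, e = 1 the identity, and e = 0 maps everything into ℤ/q.
  module Frobenius {h : ℕ} (q-prime : Prime (suc (h ℕ.+ h))) where

    open ModPrime q-prime using (q; fermat; fermat-unit; square≈1; inverse; inverse-*)
    open OddPrime {h} q-prime using (half; half-*; h-nonZero; 2≉0)
    open import Algebra.Properties.CommutativeSemigroup (CommutativeRing.*-commutativeSemigroup (ℤ[θ]/ q)) using (x∙yz≈y∙xz)
    open CommutativeRing (ℤ[θ]/ q) using (setoid; semiring; commutativeSemiring; reflexive; trans; sym;
      +-cong; +-congˡ; +-congʳ; +-identityʳ; *-cong; *-congˡ; *-congʳ; *-assoc; *-comm; *-identityˡ; *-identityʳ; zeroˡ)
    open import Algebra.Properties.Semiring.Mult semiring using () renaming (_×_ to _×ₘ_)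
    open import Algebra.Properties.Semiring.Exp semiring using (_^_; ^-homo-*)
    open import Algebra.Properties.CommutativeSemiring.Exp commutativeSemiring using (^-distrib-*)
    open import Relation.Binary.Reasoning.Setoid setoid

    e : ℤ
    e = Δ ℤ.^ h

    ×ₘ-oneI : ∀ k → k ×ₘ oneI ≡ ι (+ k)
    ×ₘ-oneI zero = refl
    ×ₘ-oneI (suc k) = cong (λ u → addI oneI u) (×ₘ-oneI k)

    q×1≈0 : q ×ₘ oneI ≈I zeroI [mod q ]
    q×1≈0 = trans (reflexive (×ₘ-oneI q)) (ι-cong n≈0)

    ι-^ : ∀ a k → ι a ^ k ≡ ι (a ℤ.^ k)
    ι-^ a zero = refl
    ι-^ a (suc k) = ≡.trans (cong (ι a ·_) (ι-^ a k)) (ι-· a (a ℤ.^ k))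

    norm-^ : ∀ u k → norm (u ^ k) ≡ norm u ℤ.^ k
    norm-^ u zero = norm-ι 1ℤ
    norm-^ u (suc k) = ≡.trans (norm-· u (u ^ k)) (cong (norm u *_) (norm-^ u k))

    freshman : ∀ u v → addI u v ^ q ≈I addI (u ^ q) (v ^ q) [mod q ]
    freshman = freshmans-dream commutativeSemiring q-prime q×1≈0

    ι-fermat : ∀ a → ι a ^ q ≈I ι a [mod q ]
    ι-fermat a = trans (reflexive (ι-^ a q)) (ι-cong (fermat a))

    δ^q : δ ^ q ≈I ι e · δ [mod q ]
    δ^q = begin
      δ · δ ^ (h ℕ.+ h)        ≈⟨ *-congˡ {δ} (^-homo-* δ h h) ⟩
      δ · (δ ^ h · δ ^ h)      ≈⟨ *-congˡ {δ} (^-distrib-* δ δ h) ⟨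
      δ · (δ · δ) ^ h          ≡⟨ cong (λ x → δ · x ^ h) δ·δ ⟩
      δ · ι Δ ^ h              ≡⟨ cong (δ ·_) (ι-^ Δ h) ⟩
      δ · ι e                  ≈⟨ *-comm δ (ι e) ⟩
      ι e · δ                  ∎

    twice-^q : ∀ a b → ι (+ 2) · (a , b) ^ q ≈I addI (ι (+ 2 * a + s * b)) (ι (b * e) · δ) [mod q ]
    twice-^q a b = begin
      ι (+ 2) · (a , b) ^ q                    ≈⟨ *-congʳ {(a , b) ^ q} (ι-fermat (+ 2)) ⟨
      ι (+ 2) ^ q · (a , b) ^ q                ≈⟨ ^-distrib-* (ι (+ 2)) (a , b) q ⟨
      (ι (+ 2) · (a , b)) ^ q                  ≡⟨ cong (_^ q) (twice a b) ⟩
      addI (ι x) (ι b · δ) ^ q                 ≈⟨ freshman (ι x) (ι b · δ) ⟩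
      addI (ι x ^ q) ((ι b · δ) ^ q)           ≈⟨ +-cong (ι-fermat x) (^-distrib-* (ι b) δ q) ⟩
      addI (ι x) (ι b ^ q · δ ^ q)             ≈⟨ +-congˡ {ι x} (*-cong (ι-fermat b) δ^q) ⟩
      addI (ι x) (ι b · (ι e · δ))             ≈⟨ +-congˡ {ι x} (*-assoc (ι b) (ι e) δ) ⟨
      addI (ι x) (ι b · ι e · δ)               ≡⟨ cong (λ y → addI (ι x) (y · δ)) (ι-· b e) ⟩
      addI (ι x) (ι (b * e) · δ)               ∎
      where
      x : ℤ
      x = + 2 * a + s * b

    unhalve : ∀ u → ι half · (ι (+ 2) · u) ≈I u [mod q ]
    unhalve u = begin
      ι half · (ι (+ 2) · u)     ≈⟨ *-assoc (ι half) (ι (+ 2)) u ⟨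
      ι half · ι (+ 2) · u       ≡⟨ cong (_· u) (ι-· half (+ 2)) ⟩
      ι (half * + 2) · u         ≈⟨ *-congʳ {u} (ι-cong half-*) ⟩
      oneI · u                   ≈⟨ *-identityˡ u ⟩
      u                          ∎

    private
      ^q-via-e : ∀ a b {c} → b * e ≈ c [mod q ] →
                 (a , b) ^ q ≈I ι half · addI (ι (+ 2 * a + s * b)) (ι c · δ) [mod q ]
      ^q-via-e a b {c} be≈c = begin
        (a , b) ^ q                                     ≈⟨ unhalve ((a , b) ^ q) ⟨
        ι half · (ι (+ 2) · (a , b) ^ q)                ≈⟨ *-congˡ {ι half} (twice-^q a b) ⟩
        ι half · addI (ι x) (ι (b * e) · δ)             ≈⟨ *-congˡ {ι half} (+-congˡ {ι x} (*-congʳ {δ} c≈)) ⟩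
        ι half · addI (ι x) (ι c · δ)                   ∎
        where
        x : ℤ
        x = + 2 * a + s * b
        c≈ : ι (b * e) ≈I ι c [mod q ]
        c≈ = ι-cong be≈c

    frobenius-conj : e ≈ - 1ℤ [mod q ] → ∀ u → u ^ q ≈I conj u [mod q ]
    frobenius-conj e≈-1 (a , b) = begin
      (a , b) ^ q                                  ≈⟨ ^q-via-e a b b·e≈-b ⟩
      ι half · addI (ι (+ 2 * a + s * b)) (ι (- b) · δ) ≡⟨ cong (ι half ·_) (twice-conj a b) ⟨
      ι half · (ι (+ 2) · conj (a , b))            ≈⟨ unhalve (conj (a , b)) ⟩
      conj (a , b)                                 ∎
      where
      b·e≈-b : b * e ≈ - b [mod q ]
      b·e≈-b = ≈-trans (≈-*-cong (≈-refl {x = b}) e≈-1) (≈-reflexive (≡.trans (ℤ.*-comm b (- 1ℤ)) (ℤ.-1*i≡-i b)))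

    frobenius-id : e ≈ 1ℤ [mod q ] → ∀ u → u ^ q ≈I u [mod q ]
    frobenius-id e≈1 (a , b) = begin
      (a , b) ^ q                                  ≈⟨ ^q-via-e a b b·e≈b ⟩
      ι half · addI (ι (+ 2 * a + s * b)) (ι b · δ) ≡⟨ cong (ι half ·_) (twice a b) ⟨
      ι half · (ι (+ 2) · (a , b))                 ≈⟨ unhalve (a , b) ⟩
      (a , b)                                      ∎
      where
      b·e≈b : b * e ≈ b [mod q ]
      b·e≈b = ≈-trans (≈-*-cong (≈-refl {x = b}) e≈1) (≈-reflexive (ℤ.*-identityʳ b))

    frobenius-scalar : e ≈ 0ℤ [mod q ] → ∀ u → ∃ λ l → u ^ q ≈I ι l [mod q ]
    frobenius-scalar e≈0 (a , b) = half * x , (begin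
      (a , b) ^ q                      ≈⟨ ^q-via-e a b b·e≈0 ⟩
      ι half · addI (ι x) (zeroI · δ)  ≈⟨ *-congˡ {ι half} (+-congˡ {ι x} (zeroˡ δ)) ⟩
      ι half · addI (ι x) zeroI        ≈⟨ *-congˡ {ι half} (+-identityʳ (ι x)) ⟩
      ι half · ι x                     ≡⟨ ι-· half x ⟩
      ι (half * x)                     ∎)
      where
      x : ℤ
      x = + 2 * a + s * b
      b·e≈0 : b * e ≈ 0ℤ [mod q ]
      b·e≈0 = ≈-trans (≈-*-cong (≈-refl {x = b}) e≈0) (≈-reflexive (ℤ.*-zeroʳ b))

    private
      0^ : ∀ k → .{{ℕ.NonZero k}} → 0ℤ ℤ.^ k ≡ 0ℤ
      0^ (suc k) = ℤ.*-zeroˡ (0ℤ ℤ.^ k)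

    classify : e ≈ 0ℤ [mod q ] ⊎ e ≈ 1ℤ [mod q ] ⊎ e ≈ - 1ℤ [mod q ]
    classify with ≈0? Δ
    ... | yes Δ≈0 = inj₁ (≈-trans (≈-^-cong h Δ≈0) (≈-reflexive (0^ h)))
    ... | no Δ≉0 = inj₂ (square≈1 (≈-trans (≈-reflexive (≡.sym (ℤ.^-distribˡ-+-* Δ h h))) (fermat-unit Δ≉0)))

    conj-·-unit : ∀ u → norm u ≈ 1ℤ [mod q ] → conj u · u ≈I oneI [mod q ]
    conj-·-unit u N≈1 = trans (reflexive (conj-·-self u)) (ι-cong N≈1)

    order-conj : e ≈ - 1ℤ [mod q ] → ∀ u → norm u ≈ 1ℤ [mod q ] → u ^ suc q ≈I oneI [mod q ]
    order-conj e≈-1 u N≈1 = begin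
      u · u ^ q              ≈⟨ *-congˡ {u} (frobenius-conj e≈-1 u) ⟩
      u · conj u             ≈⟨ *-comm u (conj u) ⟩
      conj u · u             ≈⟨ conj-·-unit u N≈1 ⟩
      oneI                   ∎

    order-id : e ≈ 1ℤ [mod q ] → ∀ u → norm u ≈ 1ℤ [mod q ] → u ^ (h ℕ.+ h) ≈I oneI [mod q ]
    order-id e≈1 u N≈1 = begin
      u ^ m                  ≈⟨ *-identityʳ (u ^ m) ⟨
      u ^ m · oneI           ≈⟨ *-congˡ {u ^ m} (conj-·-unit u N≈1) ⟨
      u ^ m · (conj u · u)   ≈⟨ x∙yz≈y∙xz (u ^ m) (conj u) u ⟩
      conj u · (u ^ m · u)   ≈⟨ *-congˡ {conj u} (*-comm (u ^ m) u) ⟩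
      conj u · u ^ q         ≈⟨ *-congˡ {conj u} (frobenius-id e≈1 u) ⟩
      conj u · u             ≈⟨ conj-·-unit u N≈1 ⟩
      oneI                   ∎
      where
      m : ℕ
      m = h ℕ.+ h

    order-scalar : e ≈ 0ℤ [mod q ] → ∀ u → norm u ≈ 1ℤ [mod q ] → u ^ (q ℕ.+ q) ≈I oneI [mod q ]
    order-scalar e≈0 u N≈1 = square (frobenius-scalar e≈0 u)
      where
      square : (∃ λ l → u ^ q ≈I ι l [mod q ]) → u ^ (q ℕ.+ q) ≈I oneI [mod q ]
      square (l , u^q≈l) = begin
        u ^ (q ℕ.+ q)          ≈⟨ ^-homo-* u q q ⟩
        u ^ q · u ^ q          ≈⟨ *-cong u^q≈l u^q≈l ⟩
        ι l · ι l              ≡⟨ ι-· l l ⟩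
        ι (l * l)              ≈⟨ ι-cong l²≈1 ⟩
        oneI                   ∎
        where
        l²≈1 : l * l ≈ 1ℤ [mod q ]
        l²≈1 = ≈-trans (≈-reflexive (≡.sym (norm-ι l)))
                 (≈-trans (norm-cong (sym u^q≈l))
                 (≈-trans (≈-reflexive (norm-^ u q))
                 (≈-trans (≈-^-cong q N≈1) (≈-reflexive (ℤ.^-zeroˡ q)))))

    unit-order : ∀ u → norm u ≈ 1ℤ [mod q ] →
                 u ^ (q ℕ.+ q) ≈I oneI [mod q ] ⊎ u ^ (h ℕ.+ h) ≈I oneI [mod q ] ⊎ u ^ suc q ≈I oneI [mod q ]
    unit-order u N≈1 = Data.Sum.map (λ e≈0 → order-scalar e≈0 u N≈1)
                         (Data.Sum.map (λ e≈1 → order-id e≈1 u N≈1) (λ e≈-1 → order-conj e≈-1 u N≈1)) classify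

    module Field (Δ-nonresidue : ∀ y → ¬ y * y ≈ Δ [mod q ]) where

      -- 4·norm (a , b) = (2a + sb)² - Δb², so an invertible b would give the square root (2a + sb)/b of Δ.
      norm≈0⇒≈0 : ∀ u → norm u ≈ 0ℤ [mod q ] → u ≈I zeroI [mod q ]
      norm≈0⇒≈0 (a , b) N≈0 = by-cases (≈0? b)
        where
        x : ℤ
        x = + 2 * a + s * b

        x²≈Δb² : x * x ≈ Δ * b * b [mod q ]
        x²≈Δb² = ≈-trans (≈-reflexive (square-identity a b))
                   (≈-trans (≈-+-cong (≈-*-cong (≈-refl {x = + 4}) N≈0) (≈-refl {x = Δ * b * b}))
                            (≈-reflexive (ℤ.+-identityˡ (Δ * b * b))))

        by-cases : Dec (b ≈ 0ℤ [mod q ]) → (a , b) ≈I zeroI [mod q ]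
        by-cases (no b≉0) = contradiction y²≈Δ (Δ-nonresidue y)
          where
          i y : ℤ
          i = inverse b
          y = x * i
          regroup : ∀ x i → x * i * (x * i) ≡ x * x * (i * i)
          regroup = solve-∀
          regroup′ : ∀ Δ b i → Δ * b * b * (i * i) ≡ Δ * ((b * i) * (b * i))
          regroup′ = solve-∀
          y²≈Δ : y * y ≈ Δ [mod q ]
          y²≈Δ = ≈-trans (≈-reflexive (regroup x i))
                   (≈-trans (≈-*-cong x²≈Δb² (≈-refl {x = i * i}))
                   (≈-trans (≈-reflexive (regroup′ Δ b i))
                   (≈-trans (≈-*-cong (≈-refl {x = Δ}) (≈-*-cong (inverse-* b≉0) (inverse-* b≉0)))
                            (≈-reflexive (ℤ.*-identityʳ Δ)))))
        by-cases (yes b≈0) = a≈0 & b≈0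
          where
          x≈0 : x ≈ 0ℤ [mod q ]
          x≈0 = [ id , id ]′ (prime-≈0-* q-prime (≈-trans x²≈Δb²
                  (≈-trans (≈-*-cong (≈-*-cong (≈-refl {x = Δ}) b≈0) b≈0) (≈-reflexive (ℤ.*-zeroʳ (Δ * 0ℤ))))))
          unshift : ∀ a b s → + 2 * a ≡ (+ 2 * a + s * b) - s * b
          unshift = solve-∀
          vanish : ∀ s → 0ℤ - s * 0ℤ ≡ 0ℤ
          vanish = solve-∀
          2a≈0 : + 2 * a ≈ 0ℤ [mod q ]
          2a≈0 = ≈-trans (≈-reflexive (unshift a b s))
                   (≈-trans (≈-+-cong x≈0 (≈-neg-cong (≈-*-cong (≈-refl {x = s}) b≈0)))
                            (≈-reflexive (vanish s)))
          a≈0 : a ≈ 0ℤ [mod q ]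
          a≈0 = [ flip contradiction 2≉0 , id ]′ (prime-≈0-* q-prime 2a≈0)

      domain : ∀ u v → u · v ≈I zeroI [mod q ] → u ≈I zeroI [mod q ] ⊎ v ≈I zeroI [mod q ]
      domain u v uv≈0 = Data.Sum.map (norm≈0⇒≈0 u) (norm≈0⇒≈0 v) (prime-≈0-* q-prime Nu·Nv≈0)
        where
        Nu·Nv≈0 : norm u * norm v ≈ 0ℤ [mod q ]
        Nu·Nv≈0 = ≈-trans (≈-reflexive (≡.sym (norm-· u v))) (≈-trans (norm-cong uv≈0) (≈-reflexive (norm-ι 0ℤ)))

-- ℤ[√D], ℤ[ω] and the Jacobi symbol

quarter-exact : ∀ m → (m ℤ.* + 4) ℤ./ + 4 ≡ m
quarter-exact m = ≡.sym (ℤ.i-j≡0⇒i≡j m y (ℤ.∣i∣≡0⇒i≡0 (small ∣m-y∣*4<4)))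
  where
  y : ℤ
  y = (m ℤ.* + 4) ℤ./ + 4
  r : ℕ
  r = (m ℤ.* + 4) ℤ.% + 4
  r≡[m-y]*4 : + r ≡ (m ℤ.- y) ℤ.* + 4
  r≡[m-y]*4 = begin
    + r                              ≡⟨ cancel (+ r) (y ℤ.* + 4) ⟩
    + r ℤ.+ y ℤ.* + 4 ℤ.- y ℤ.* + 4  ≡⟨ cong (ℤ._- y ℤ.* + 4) (ℤ.a≡a%n+[a/n]*n (m ℤ.* + 4) (+ 4)) ⟨
    m ℤ.* + 4 ℤ.- y ℤ.* + 4          ≡⟨ factor m y ⟩
    (m ℤ.- y) ℤ.* + 4                ∎
    where
    open ≡.≡-Reasoning
    cancel : ∀ r z → r ≡ r ℤ.+ z ℤ.- z
    cancel = solve-∀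
    factor : ∀ m y → m ℤ.* + 4 ℤ.- y ℤ.* + 4 ≡ (m ℤ.- y) ℤ.* + 4
    factor = solve-∀
  ∣m-y∣*4<4 : ∣ m ℤ.- y ∣ ℕ.* 4 ℕ.< 4
  ∣m-y∣*4<4 = subst (ℕ._< 4) (≡.trans (cong ∣_∣ r≡[m-y]*4) (ℤ.abs-* (m ℤ.- y) (+ 4))) (ℤ.n%d<d (m ℤ.* + 4) (+ 4))
  small : ∀ {k} → k ℕ.* 4 ℕ.< 4 → k ≡ 0
  small {zero} _ = refl
  small {suc k} (ℕ.s≤s (ℕ.s≤s (ℕ.s≤s (ℕ.s≤s ()))))

oneMod4⇒≡1+4k : ∀ D → oneMod4 D ≡ true → D ≡ 1ℤ ℤ.+ (D ℤ./ + 4) ℤ.* + 4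
oneMod4⇒≡1+4k D oneMod4≡true =
  ≡.trans (ℤ.a≡a%n+[a/n]*n D (+ 4)) (cong (λ r → + r ℤ.+ (D ℤ./ + 4) ℤ.* + 4) (%≡1 oneMod4≡true))
  where
  %≡1 : oneMod4 D ≡ true → D ℤ.% + 4 ≡ 1
  %≡1 with D ℤ.% + 4
  ... | 0 = λ ()
  ... | 1 = λ _ → refl
  ... | suc (suc _) = λ ()

sD : ℤ → ℤ
sD D = if oneMod4 D then 1ℤ else 0ℤ

tD : ℤ → ℤ
tD D = if oneMod4 D then (D ℤ.- 1ℤ) ℤ./ + 4 else D

module _ (D : ℤ) where

  open import Data.Integer using (_+_; _*_; _-_)
  open import Data.Integer.DivMod using (_/_)

  open Quadratic (sD D) (tD D) using (_·_; norm; Δ; ℤ[θ]/_)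

  private
    quarters : oneMod4 D ≡ true → (D - 1ℤ) / + 4 ≡ D / + 4 × (1ℤ - D) / + 4 ≡ - (D / + 4)
    quarters oneMod4≡true =
      ≡.trans (cong (λ x → (x - 1ℤ) / + 4) D≡) (≡.trans (cong (_/ + 4) (minus-one k)) (quarter-exact k)) ,
      ≡.trans (cong (λ x → (1ℤ - x) / + 4) D≡) (≡.trans (cong (_/ + 4) (one-minus k)) (quarter-exact (- k)))
      where
      k : ℤ
      k = D / + 4
      D≡ : D ≡ 1ℤ + k * + 4
      D≡ = oneMod4⇒≡1+4k D oneMod4≡true
      minus-one : ∀ k → 1ℤ + k * + 4 - 1ℤ ≡ k * + 4
      minus-one = solve-∀
      one-minus : ∀ k → 1ℤ - (1ℤ + k * + 4) ≡ - k * + 4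
      one-minus = solve-∀

  mulI≡· : ∀ u v → mulI D u v ≡ u · v
  mulI≡· (a , b) (c , d) with oneMod4 D
  ... | false = cong (a * c + D * b * d ,_) (no-ω a b c d)
    where
    no-ω : ∀ a b c d → a * d + b * c ≡ a * d + b * c + 0ℤ * b * d
    no-ω = solve-∀
  ... | true = cong (a * c + ((D - 1ℤ) / + 4) * b * d ,_) (ω a b c d)
    where
    ω : ∀ a b c d → a * d + b * c + b * d ≡ a * d + b * c + 1ℤ * b * d
    ω = solve-∀

  normI≡norm : ∀ u → normI D u ≡ norm u
  normI≡norm (a , b) with oneMod4 D in oneMod4≡
  ... | false = no-ω a b D
    where
    no-ω : ∀ a b D → a * a - D * b * b ≡ a * a + 0ℤ * a * b - D * b * b
    no-ω = solve-∀
  ... | true with [D-1]/4≡k , [1-D]/4≡-k ← quarters oneMod4≡ = begin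
    a * a + a * b + ((1ℤ - D) / + 4) * b * b       ≡⟨ cong (λ z → a * a + a * b + z * b * b) [1-D]/4≡-k ⟩
    a * a + a * b + - k * b * b                    ≡⟨ ω a b k ⟩
    a * a + 1ℤ * a * b - k * b * b                 ≡⟨ cong (λ z → a * a + 1ℤ * a * b - z * b * b) [D-1]/4≡k ⟨
    a * a + 1ℤ * a * b - ((D - 1ℤ) / + 4) * b * b  ∎
    where
    open ≡.≡-Reasoning
    k : ℤ
    k = D / + 4
    ω : ∀ a b k → a * a + a * b + - k * b * b ≡ a * a + 1ℤ * a * b - k * b * b
    ω = solve-∀

  Δ≡D⊎4D : Δ ≡ D ⊎ Δ ≡ + 4 * D
  Δ≡D⊎4D with oneMod4 D in oneMod4≡
  ... | false = inj₂ (ℤ.+-identityˡ (+ 4 * D))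
  ... | true = inj₁ (begin
    1ℤ * 1ℤ + + 4 * ((D - 1ℤ) / + 4)  ≡⟨ cong (λ z → 1ℤ + + 4 * z) (proj₁ (quarters oneMod4≡)) ⟩
    1ℤ + + 4 * (D / + 4)              ≡⟨ cong (λ z → 1ℤ + z) (ℤ.*-comm (+ 4) (D / + 4)) ⟩
    1ℤ + (D / + 4) * + 4              ≡⟨ oneMod4⇒≡1+4k D oneMod4≡ ⟨
    D                                 ∎)
    where open ≡.≡-Reasoning

  module _ {n : ℕ} where

    open CommutativeRing (ℤ[θ]/ n) using (semiring; reflexive; trans; +-cong; *-congʳ; *-comm)
    open import Algebra.Properties.Semiring.Exp semiring using (_^_)
    open Powers (ℤ[θ]/ n) using (geometric)

    powI≈^ : ∀ w k → powI D w k ≈I w ^ k [mod n ]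
    powI≈^ w zero = reflexive refl
    powI≈^ w (suc k) =
      trans (reflexive (mulI≡· (powI D w k) w)) (trans (*-congʳ {w} (powI≈^ w k)) (*-comm (w ^ k) w))

    cyclotomicI≈geometric : ∀ p x → cyclotomicI D p x ≈I geometric x p [mod n ]
    cyclotomicI≈geometric zero x = reflexive refl
    cyclotomicI≈geometric (suc p) x = +-cong (cyclotomicI≈geometric p x) (powI≈^ x p)

  Δ-nonresidue : ∀ {h} → Prime (suc (h ℕ.+ h)) →
                 (∀ y → ¬ y * y ≈ D [mod suc (h ℕ.+ h) ]) → ∀ y → ¬ y * y ≈ Δ [mod suc (h ℕ.+ h) ]
  Δ-nonresidue {h} q-prime D-nonresidue y y²≈Δ = [ Δ≡D⇒ , Δ≡4D⇒ ]′ Δ≡D⊎4D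
    where
    open OddPrime {h} q-prime using (half; half-*)
    Δ≡D⇒ : Δ ≡ D → ⊥
    Δ≡D⇒ Δ≡D = D-nonresidue y (subst (λ z → y * y ≈ z [mod _ ]) Δ≡D y²≈Δ)
    regroup : ∀ y h → y * h * (y * h) ≡ y * y * (h * h)
    regroup = solve-∀
    regroup′ : ∀ D h → + 4 * D * (h * h) ≡ D * (h * + 2 * (h * + 2))
    regroup′ = solve-∀
    Δ≡4D⇒ : Δ ≡ + 4 * D → ⊥
    Δ≡4D⇒ Δ≡4D = D-nonresidue (y * half)
      (≈-trans (≈-reflexive (regroup y half))
      (≈-trans (≈-*-cong (subst (λ z → y * y ≈ z [mod _ ]) Δ≡4D y²≈Δ) (≈-refl {x = half * half}))
      (≈-trans (≈-reflexive (regroup′ D half))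
      (≈-trans (≈-*-cong (≈-refl {x = D}) (≈-*-cong half-* half-*))
               (≈-reflexive (ℤ.*-identityʳ D))))))

jacobi-1 : ∀ {a n s} → JacobiIs a n s → n ≡ 1 → s ≡ 1ℤ
jacobi-1 jac-one _ = refl
jacobi-1 (jac-mul {q} {m} q-prime _ _ _) qm≡1 = contradiction (ℕ.m*n≡1⇒m≡1 q m qm≡1) (ℕ.>⇒≢ (prime>1 q-prime))

jacobi-prime : ∀ {a n r} → Prime n → JacobiIs a n r → r ≡ - 1ℤ → ∀ y → ¬ y ℤ.* y ≈ a [mod n ]
jacobi-prime {a} n-prime (jac-mul {q} {m} {s} {t} q-prime _ legendre jacobi) st≡-1 y y²≈a = nonresidue legendre s≡-1
  where
  instance _ = prime⇒nonZero q-prime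
  m≡1 : m ≡ 1
  m≡1 = [ flip contradiction (ℕ.>⇒≢ (prime>1 q-prime))
        , (λ q≡qm → ℕ.*-cancelˡ-≡ m 1 q (≡.trans (≡.sym q≡qm) (≡.sym (ℕ.*-identityʳ q)))) ]′
        (prime⇒irreducible n-prime (ℕ.m∣m*n m))
  s≡-1 : s ≡ - 1ℤ
  s≡-1 = ≡.trans (≡.sym (ℤ.*-identityʳ s)) (≡.trans (cong (s ℤ.*_) (≡.sym (jacobi-1 jacobi m≡1))) st≡-1)
  nonresidue : ∀ {s} → LegendreIs a q s → s ≡ - 1ℤ → ⊥
  nonresidue (leg-zero _) ()
  nonresidue (leg-res _ _) ()
  nonresidue (leg-non _ no-root) _ = no-root y (≈⇒≡ᵢ (≈-weaken (ℕ.m∣m*n m) y²≈a))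

prime⇒cyclotomic≈0 : ∀ D {N h p E} w → N ≡ suc (h ℕ.+ h) → Prime N → JacobiIs D N (- 1ℤ) → InG N D w →
                     E ℕ.* p ≡ suc N → ¬ powI D w E ≡I oneI [mod N ] →
                     cyclotomicI D p (powI D w E) ≡I zeroI [mod N ]
prime⇒cyclotomic≈0 D {N} {h} {p} {E} w refl N-prime jacobi w∈G Ep≡N+1 X≢1 =
  ≈I⇒≡I (trans (cyclotomicI≈geometric D p X) G≈0)
  where
  open Quadratic (sD D) (tD D) using (norm; ℤ[θ]/_; module Frobenius)
  open Frobenius {h} N-prime using (order-conj; module Field)
  open Field (Δ-nonresidue D {h} N-prime (jacobi-prime N-prime jacobi refl)) using (domain)
  open OddPrime {h} N-prime using (euler-nonresidue)
  open CommutativeRing (ℤ[θ]/ N) using (setoid; semiring; trans; 1#; 0#; _-_; +-group)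
  open import Algebra.Properties.Semiring.Exp semiring using (_^_; ^-congˡ; ^-assocʳ)
  open import Algebra.Properties.Group +-group using (identityˡ-unique; x∙y⁻¹≈ε⇒x≈y)
  open Powers (ℤ[θ]/ N) using (geometric; geometric-*)
  open import Relation.Binary.Reasoning.Setoid setoid

  X : Elt
  X = powI D w E
  norm-w≈1 : norm w ≈ 1ℤ [mod N ]
  norm-w≈1 = subst (λ z → z ≈ 1ℤ [mod N ]) (normI≡norm D w) (≡ᵢ⇒≈ w∈G)
  X^p≈1 : X ^ p ≈I 1# [mod N ]
  X^p≈1 = begin
    X ^ p          ≈⟨ ^-congˡ p (powI≈^ D w E) ⟩
    (w ^ E) ^ p    ≈⟨ ^-assocʳ w E p ⟩
    w ^ (E ℕ.* p)  ≡⟨ cong (w ^_) Ep≡N+1 ⟩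
    w ^ suc N      ≈⟨ order-conj (euler-nonresidue (Δ-nonresidue D {h} N-prime (jacobi-prime N-prime jacobi refl))) w norm-w≈1 ⟩
    1#             ∎
  G≈0 : geometric X p ≈I 0# [mod N ]
  G≈0 = [ id , (λ X-1≈0 → contradiction (≈I⇒≡I (x∙y⁻¹≈ε⇒x≈y X 1# X-1≈0)) X≢1) ]′
          (domain _ _ (identityˡ-unique _ 1# (trans (geometric-* X p) X^p≈1)))

module Converse (D : ℤ) {p u ℓ N E : ℕ} (w : Elt) (p-prime : Prime p) (p≢2 : p ≢ 2) (2∤N : ¬ 2 ℕ.∣ N)
                (N+1≡uP : suc N ≡ u ℕ.* p ℕ.^ suc ℓ) (E≡ : E ≡ u ℕ.* p ℕ.^ ℓ) (w∈G : InG N D w)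
                (Φ≈0 : cyclotomicI D p (powI D w E) ≡I zeroI [mod N ]) where

  open Quadratic (sD D) (tD D) using (norm; ι; ℤ[θ]/_; module Frobenius)

  private
    P : ℕ
    P = p ℕ.^ suc ℓ
    X : Elt
    X = powI D w E

  p∤N : ¬ p ℕ.∣ N
  p∤N p∣N = contradiction (ℕ.∣1⇒≡1 (ℕ.∣m+n∣m⇒∣n p∣N+1 p∣N)) (ℕ.>⇒≢ (prime>1 p-prime))
    where
    p∣N+1 : p ℕ.∣ N ℕ.+ 1
    p∣N+1 = subst (p ℕ.∣_) (≡.trans (≡.sym N+1≡uP) (ℕ.+-comm 1 N))
                  (ℕ.∣-trans (ℕ.m∣m*n (p ℕ.^ ℓ)) (ℕ.n∣m*n u))

  module OddFactor {h} (r-prime : Prime (suc (h ℕ.+ h))) (r∣N : suc (h ℕ.+ h) ℕ.∣ N) where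

    private
      r : ℕ
      r = suc (h ℕ.+ h)
    open Frobenius {h} r-prime using (unit-order; ×ₘ-oneI)
    open OddPrime {h} r-prime using (h-nonZero)
    open CommutativeRing (ℤ[θ]/ r)
      using (setoid; semiring; sym; trans; reflexive; 1#; 0#; _+_; _*_; _-_; +-congʳ; *-congʳ; +-identityˡ; zeroˡ)
    open import Algebra.Properties.Semiring.Exp semiring using (_^_; ^-congˡ; ^-assocʳ)
    open import Algebra.Properties.Semiring.Mult semiring using () renaming (_×_ to _×ₘ_)
    open Powers (ℤ[θ]/ r) using (geometric; geometric-*; geometric-cong; geometric-one; prime-power-order)
    open import Relation.Binary.Reasoning.Setoid setoid

    cyclotomic≈0 : geometric X p ≈I 0# [mod r ]
    cyclotomic≈0 = trans (sym (cyclotomicI≈geometric D p X)) (≈I-weaken r∣N (≡I⇒≈I Φ≈0))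

    X^p≈1 : X ^ p ≈I 1# [mod r ]
    X^p≈1 = begin
      X ^ p                         ≈⟨ geometric-* X p ⟨
      geometric X p * (X - 1#) + 1# ≈⟨ +-congʳ (trans (*-congʳ {X - 1#} cyclotomic≈0) (zeroˡ (X - 1#))) ⟩
      0# + 1#                       ≈⟨ +-identityˡ 1# ⟩
      1#                            ∎

    w^uP≈1 : w ^ (u ℕ.* P) ≈I 1# [mod r ]
    w^uP≈1 = begin
      w ^ (u ℕ.* P)                 ≡⟨ cong (w ^_) (≡.trans (≡.sym (*-^-suc u p ℓ)) (cong (ℕ._* p) (≡.sym E≡))) ⟩
      w ^ (E ℕ.* p)                 ≈⟨ ^-assocʳ w E p ⟨
      (w ^ E) ^ p                   ≈⟨ ^-congˡ p (powI≈^ D w E) ⟨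
      X ^ p                         ≈⟨ X^p≈1 ⟩
      1#                            ∎

    w^E≉1 : ¬ w ^ (u ℕ.* p ℕ.^ ℓ) ≈I 1# [mod r ]
    w^E≉1 w^E≈1 = [ flip contradiction (ℕ.>⇒≢ (prime>1 r-prime)) , (λ r≡p → p∤N (subst (ℕ._∣ N) r≡p r∣N)) ]′
                    (prime⇒irreducible p-prime (≈0⇒∣ (_≈I_[mod_].≈₁ p≈0)))
      where
      X≈1 : X ≈I 1# [mod r ]
      X≈1 = trans (powI≈^ D w E) (trans (reflexive (cong (w ^_) E≡)) w^E≈1)
      p≈0 : ι (+ p) ≈I 0# [mod r ]
      p≈0 = begin
        ι (+ p)          ≡⟨ ×ₘ-oneI p ⟨
        p ×ₘ 1#          ≈⟨ geometric-one p ⟨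
        geometric 1# p   ≈⟨ geometric-cong p X≈1 ⟨
        geometric X p    ≈⟨ cyclotomic≈0 ⟩
        0#               ∎

    P∣order : ∀ {M} → w ^ M ≈I 1# [mod r ] → P ℕ.∣ M
    P∣order = prime-power-order {x = w} p-prime u ℓ w^uP≈1 w^E≉1

    norm-w≈1 : norm w ≈ 1ℤ [mod r ]
    norm-w≈1 = ≈-weaken r∣N (subst (λ z → z ≈ 1ℤ [mod N ]) (normI≡norm D w) (≡ᵢ⇒≈ w∈G))

    P≤r : P ℕ.≤ r
    P≤r = prime-power-≤ p-prime p≢2 (ℕ.>-nonZero⁻¹ h) (p∤N ∘ flip ℕ.∣-trans r∣N) ℓ
            (Data.Sum.map P∣order (Data.Sum.map P∣order P∣order) (unit-order w norm-w≈1))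

  prime : 1 ℕ.< N → u ℕ.< P → Prime N
  prime 1<N u<P = prime-if-factors-≥ 1<N N<P² P≤factor
    where
    instance
      _ = prime⇒nonZero p-prime
      _ = ℕ.>-nonZero (ℕ.m^n>0 p (suc ℓ))
    N<P² : N ℕ.< P ℕ.* P
    N<P² = ℕ.<-≤-trans (ℕ.n<1+n N) (ℕ.≤-trans (ℕ.≤-reflexive N+1≡uP) (ℕ.<⇒≤ (ℕ.*-monoˡ-< P u<P)))
    P≤factor : ∀ {r} → Prime r → r ℕ.∣ N → P ℕ.≤ r
    P≤factor r-prime r∣N with h , refl ← odd-form (2∤N ∘ flip ℕ.∣-trans r∣N) = OddFactor.P≤r {h} r-prime r∣N

open import Data.Nat using (_+_; _*_; _∸_; _^_; _≤_; _<_; _%_; _/_; NonZero)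
open import Function.Bundles using (_⇔_; mk⇔)

theorem1p1 : (D : ℤ) → SquareFree D → D ≢ + 1 →
    (p : ℕ) → .{{_ : NonZero p}} → Prime p → p ≢ 2 →
    (k ℓ cD : ℕ) → 1 ≤ k → 1 ≤ ℓ → 1 ≤ cD → gcd (cD * k) p ≡ 1 →
    let N = cD * k * p ^ ℓ ∸ 1 in
    N % 2 ≡ 1 → JacobiIs D N (- 1ℤ) → cD * k < p ^ ℓ →
    (w : Elt) → InG N D w → ¬ (powI D w ((N + 1) / p) ≡I oneI [mod N ]) →
    (Prime N ⇔ (cyclotomicI D p (powI D w ((N + 1) / p)) ≡I zeroI [mod N ]))
theorem1p1 D _ _ p p-prime p≢2 k (suc ℓ) cD 1≤k _ 1≤cD _ N%2≡1 jacobi u<P w w∈G w^E≢1 =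
  mk⇔ (λ N-prime → prime⇒cyclotomic≈0 D {h = h} {p} {E} w N≡2h+1 N-prime jacobi w∈G E*p≡N+1 w^E≢1)
      (λ Φ≡0 → Converse.prime D {p} {u} {ℓ} {N} {E} w p-prime p≢2 2∤N N+1≡uP E≡ w∈G Φ≡0 1<N u<P)
  where
  u N E : ℕ
  u = cD * k
  N = u * p ^ suc ℓ ∸ 1
  E = (N + 1) / p
  N+1≡uP : suc N ≡ u * p ^ suc ℓ
  N+1≡uP = ≡.trans (ℕ.+-comm 1 N) (ℕ.m∸n+n≡m (ℕ.*-mono-≤ (ℕ.*-mono-≤ 1≤cD 1≤k) (ℕ.m^n>0 p (suc ℓ))))
  uPᶫ·p≡N+1 : u * p ^ ℓ * p ≡ suc N
  uPᶫ·p≡N+1 = ≡.trans (*-^-suc u p ℓ) (≡.sym N+1≡uP)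
  E≡ : E ≡ u * p ^ ℓ
  E≡ = ≡.trans (cong (_/ p) (≡.trans (ℕ.+-comm N 1) (≡.sym uPᶫ·p≡N+1))) (ℕ.m*n/n≡m (u * p ^ ℓ) p)
  E*p≡N+1 : E * p ≡ suc N
  E*p≡N+1 = ≡.trans (cong (_* p) E≡) uPᶫ·p≡N+1
  2∤N : ¬ 2 ℕ.∣ N
  2∤N 2∣N = contradiction (≡.trans (≡.sym (ℕ.n∣m⇒m%n≡0 N 2 2∣N)) N%2≡1) λ ()
  h : ℕ
  h = proj₁ (odd-form 2∤N)
  N≡2h+1 : N ≡ suc (h + h)
  N≡2h+1 = proj₂ (odd-form 2∤N)
  1<N : 1 < N
  1<N = ℕ.≤∧≢⇒< (subst (1 ≤_) (≡.sym N≡2h+1) (ℕ.s≤s ℕ.z≤n))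
                 (λ 1≡N → contradiction (jacobi-1 jacobi (≡.sym 1≡N)) λ ())
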